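{- Let $\mathcal C,\mathcal D$ be stable configuration structures. Then $\mathcal C$ and $\mathcal D$ are hereditary weak history-preserving (HWH) bisimilar if and only if $\mathcal C\equiv_{\mathrm{EIL}_{hwh}}\mathcal D$.
   Context: Configuration structures. A configuration structure over $\mathsf{Act}$ is $\mathcal C=(C,\ell)$, $C$ a family of finite sets (configurations), $\ell:\bigcup_{X\in C}X\to\mathsf{Act}$, events $E_{\mathcal C}=\bigcup C$. Stable: $\emptyset\in C$; every nonempty $X\in C$ has $e\in X$ with $X\setminus\{e\}\in C$; for $X,Y,Z\in C$ with $X\cup Y\subseteq Z$, $X\cup Y\in C$ and $X\cap Y\in C$. For $X\in C$: $d\le_Xe$ iff every $Y\in C$ with $Y\subseteq X$ and $e\in Y$ contains $d$; $d<_Xe$ iff $d\le_Xe$, $d\neq e$. $X\xrightarrow{e}X'$ iff $X,X'\in C$, $X\subseteq X'$, $X'\setminus X=\{e\}$; $X\xrightarrow{a}X'$ iff $X\xrightarrow{e}X'$, $\ell(e)=a$. Standing assumption: image finiteness. $f:X\cong Y$ means $f$ is a label-preserving bijection with $d<_Xe\iff f(d)<_Yf(e)$. HWH bisimulation. $\mathcal R\subseteq C_{\mathcal C}\times C_{\mathcal D}\times\mathcal P(E_{\mathcal C}\times E_{\mathcal D})$ with $\mathcal R(\emptyset,\emptyset,\emptyset)$ such that whenever $\mathcal R(X,Y,f)$, $a\in\mathsf{Act}$: $f:X\cong Y$; if $X\xrightarrow{a}X'$ then $\exists Y',f'$ with $Y\xrightarrow{a}Y'$ and $\mathcal R(X',Y',f')$,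 and symmetrically for $Y\xrightarrow{a}Y'$; if $X'\xrightarrow{a}X$ then $\exists Y',f'$ with $Y'\xrightarrow{a}Y$, $\mathcal R(X',Y',f')$ and $f\restriction X'=f'$, and symmetrically for $Y'\xrightarrow{a}Y$. EIL. Syntax $\phi::=\mathrm{tt}\mid\neg\phi\mid\phi\wedge\phi'\mid\langle x:a\rangle\phi\mid(x:a)\phi\mid\langle\!\langle x\rangle\!\rangle\phi$; $\langle x:a\rangle,(x:a)$ bind $x$; $\mathrm{fi}(\langle\!\langle x\rangle\!\rangle\phi)=\mathrm{fi}(\phi)\cup\{x\}$, other clauses as usual; closed = no free identifiers. Environment $\rho$ permissible for $\phi$ and $X$: $\mathrm{fi}(\phi)\subseteq\mathrm{dom}\rho$, $\rho(\mathrm{fi}(\phi))\subseteq X$. Semantics: $\mathrm{tt},\neg,\wedge$ classical; $X,\rho\models\langle x:a\rangle\phi$ iff $\exists X',e$: $X\xrightarrow{e}X'$, $\ell(e)=a$, $X',\rho[x\mapsto e]\models\phi$; $X,\rho\models(x:a)\phi$ iff $\exists e\in X$, $\ell(e)=a$, $X,\rho[x\mapsto e]\models\phi$; $X,\rho\models\langle\!\langle x\rangle\!\rangle\phi$ iff $\exists X',e$: $X'\xrightarrow{e}X$, $\rho(x)=e$, $\rho$ permissible for $\phi$ and $X'$, $X',\rho\models\phi$. For closed $\phi$: $\mathcal C\models\phi$ iff $\emptyset,\emptyset\models\phi$. $\mathcal C\equiv_L\mathcal D$ iff for all closed $\phi\in L$: $\mathcal C\models\phi\iff\mathcal D\models\phi$.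 $\langle a\rangle\phi$ abbreviates $\langle x:a\rangle\phi$ with $x$ not free in $\phi$. Sublogic $\mathrm{EIL}_{hwh}$: $\phi::=\mathrm{tt}\mid\neg\phi\mid\phi\wedge\phi'\mid\langle a\rangle\phi_c\mid(x:a)\phi\mid\langle\!\langle x\rangle\!\rangle\phi$, where $\phi_c$ ranges over closed formulas of $\mathrm{EIL}_{hwh}$. -}

module Defs where

open import Level using (0ℓ) renaming (suc to lsuc)
open import Data.Nat using (ℕ; _≟_)
open import Data.List using (List; []; _∷_; _++_)
open import Data.List.Membership.Propositional using (_∈_)
open import Data.Maybe using (Maybe; just; nothing)
open import Data.Product using (Σ; Σ-syntax; _×_; _,_)
open import Data.Sum using (_⊎_)
open import Data.Empty using (⊥)
open import Relation.Nullary using (¬_; yes; no)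
open import Relation.Binary.PropositionalEquality using (_≡_; _≢_)
open import Function.Bundles using (_⇔_)

-- Since C is a
-- *family of sets*, configurations are identified with their element sets
-- (conf-ext); every configuration is finite (conf-fin); E_C = ⋃ C (ev-cov);
-- the labelling ℓ is defined on E_C = Ev.

record ConfStruct (Act : Set) : Set₁ where
  field
    Ev       : Set
    Conf     : Set
    mem      : Conf → Ev → Set
    ℓ        : Ev → Act
    conf-ext : ∀ X Y → (∀ e → mem X e ⇔ mem Y e) → X ≡ Y
    conf-fin : ∀ X → Σ[ xs ∈ List Ev ] (∀ e → mem X e ⇔ e ∈ xs)
    ev-cov   : ∀ e → Σ[ X ∈ Conf ] mem X e

  IsEmpty : Conf → Set
  IsEmpty X = ∀ e → ¬ mem X e

  _⊆_ : Conf → Conf → Set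
  X ⊆ Y = ∀ e → mem X e → mem Y e

  Step : Conf → Ev → Conf → Set
  Step X e X' = X ⊆ X' × mem X' e × ¬ mem X e × (∀ d → mem X' d → mem X d ⊎ d ≡ e)

  StepA : Conf → Act → Conf → Set
  StepA X a X' = Σ[ e ∈ Ev ] (Step X e X' × ℓ e ≡ a)

  _≤[_]_ : Ev → Conf → Ev → Set
  d ≤[ X ] e = ∀ Y → Y ⊆ X → mem Y e → mem Y d

  _<[_]_ : Ev → Conf → Ev → Set
  d <[ X ] e = d ≤[ X ] e × d ≢ e

  ImageFinite : Set
  ImageFinite = ∀ X a → Σ[ xs ∈ List Conf ] (∀ X' → StepA X a X' → X' ∈ xs)



record Stable {Act : Set} (C : ConfStruct Act) : Set where
  open ConfStruct C
  field
    empty∈  : Σ[ X ∈ Conf ] IsEmpty X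
    rooted  : ∀ X → Σ[ e ∈ Ev ] mem X e →
              Σ[ e ∈ Ev ] (mem X e × Σ[ X' ∈ Conf ] (∀ d → mem X' d ⇔ (mem X d × d ≢ e)))
    union∈  : ∀ X Y Z → X ⊆ Z → Y ⊆ Z →
              Σ[ W ∈ Conf ] (∀ d → mem W d ⇔ (mem X d ⊎ mem Y d))
    inter∈  : ∀ X Y Z → X ⊆ Z → Y ⊆ Z →
              Σ[ W ∈ Conf ] (∀ d → mem W d ⇔ (mem X d × mem Y d))

module _ {Act : Set} (C D : ConfStruct Act) where
  private
    module C = ConfStruct C
    module D = ConfStruct D

  Rel : Set₁
  Rel = C.Ev → D.Ev → Set

  record Iso (X : C.Conf) (Y : D.Conf) (f : Rel) : Set where
    field
      dom⊆   : ∀ d e → f d e → C.mem X d × D.mem Y e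
      total  : ∀ d → C.mem X d → Σ[ e ∈ D.Ev ] f d e
      func   : ∀ d e e' → f d e → f d e' → e ≡ e'
      inj    : ∀ d d' e → f d e → f d' e → d ≡ d'
      surj   : ∀ e → D.mem Y e → Σ[ d ∈ C.Ev ] f d e
      label  : ∀ d e → f d e → C.ℓ d ≡ D.ℓ e
      order  : ∀ d d' e e' → f d e → f d' e' → (d C.<[ X ] d') ⇔ (e D.<[ Y ] e')

  Restricts : Rel → C.Conf → Rel → Set
  Restricts f X' f' = ∀ d e → f' d e ⇔ (f d e × C.mem X' d)

  EmptyRel : Rel
  EmptyRel _ _ = ⊥

  record IsHWH (R : C.Conf → D.Conf → Rel → Set) : Set₁ where
    field
      iso  : ∀ X Y f → R X Y f → Iso X Y f
      fwdC : ∀ X Y f a X' → R X Y f → C.StepA X a X' →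
             Σ[ Y' ∈ D.Conf ] Σ[ f' ∈ Rel ] (D.StepA Y a Y' × R X' Y' f')
      fwdD : ∀ X Y f a Y' → R X Y f → D.StepA Y a Y' →
             Σ[ X' ∈ C.Conf ] Σ[ f' ∈ Rel ] (C.StepA X a X' × R X' Y' f')
      bwdC : ∀ X Y f a X' → R X Y f → C.StepA X' a X →
             Σ[ Y' ∈ D.Conf ] Σ[ f' ∈ Rel ] (D.StepA Y' a Y × R X' Y' f' × Restricts f X' f')
      bwdD : ∀ X Y f a Y' → R X Y f → D.StepA Y' a Y →
             Σ[ X' ∈ C.Conf ] Σ[ f' ∈ Rel ] (C.StepA X' a X × R X' Y' f' × Restricts f X' f')

  HWHBisimilar : Set₁
  HWHBisimilar =
    Σ[ R ∈ (C.Conf → D.Conf → Rel → Set) ]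
      (IsHWH R × Σ[ X ∈ C.Conf ] Σ[ Y ∈ D.Conf ] (C.IsEmpty X × D.IsEmpty Y × R X Y EmptyRel))

Id : Set
Id = ℕ

data Form (Act : Set) : Set where
  tt   : Form Act
  ¬'_  : Form Act → Form Act
  _∧'_ : Form Act → Form Act → Form Act
  ⟨_∶_⟩_ : Id → Act → Form Act → Form Act
  ⦅_∶_⦆_ : Id → Act → Form Act → Form Act
  ⟪_⟫_  : Id → Form Act → Form Act

removeId : Id → List Id → List Id
removeId x [] = []
removeId x (y ∷ ys) with y ≟ x
... | yes _ = removeId x ys
... | no _  = y ∷ removeId x ys

fi : {Act : Set} → Form Act → List Id
fi tt = []
fi (¬' φ) = fi φ
fi (φ ∧' ψ) = fi φ ++ fi ψ
fi (⟨ x ∶ a ⟩ φ) = removeId x (fi φ)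
fi (⦅ x ∶ a ⦆ φ) = removeId x (fi φ)
fi (⟪ x ⟫ φ) = fi φ ++ (x ∷ [])

Closed : {Act : Set} → Form Act → Set
Closed φ = fi φ ≡ []

-- The sublogic EIL_hwh: ⟨a⟩φ_c is ⟨x:a⟩φ_c with φ_c closed (so x is not free)
data Hwh {Act : Set} : Form Act → Set where
  h-tt   : Hwh tt
  h-neg  : ∀ {φ} → Hwh φ → Hwh (¬' φ)
  h-and  : ∀ {φ ψ} → Hwh φ → Hwh ψ → Hwh (φ ∧' ψ)
  h-diam : ∀ {x a φ} → Closed φ → Hwh φ → Hwh (⟨ x ∶ a ⟩ φ)
  h-has  : ∀ {x a φ} → Hwh φ → Hwh (⦅ x ∶ a ⦆ φ)
  h-rev  : ∀ {x φ} → Hwh φ → Hwh (⟪ x ⟫ φ)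

module _ {Act : Set} (C : ConfStruct Act) where
  open ConfStruct C

  Env : Set
  Env = Id → Maybe Ev

  emptyEnv : Env
  emptyEnv _ = nothing

  _[_↦_] : Env → Id → Ev → Env
  (ρ [ x ↦ e ]) y with y ≟ x
  ... | yes _ = just e
  ... | no _  = ρ y

  Permissible : Env → Form Act → Conf → Set
  Permissible ρ φ X = ∀ x → x ∈ fi φ → Σ[ e ∈ Ev ] (ρ x ≡ just e × mem X e)

  Sat : Conf → Env → Form Act → Set
  Sat X ρ tt = Data.Unit.⊤ where import Data.Unit
  Sat X ρ (¬' φ) = ¬ Sat X ρ φ
  Sat X ρ (φ ∧' ψ) = Sat X ρ φ × Sat X ρ ψ
  Sat X ρ (⟨ x ∶ a ⟩ φ) =
    Σ[ X' ∈ Conf ] Σ[ e ∈ Ev ] (Step X e X' × ℓ e ≡ a × Sat X' (ρ [ x ↦ e ]) φ)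
  Sat X ρ (⦅ x ∶ a ⦆ φ) =
    Σ[ e ∈ Ev ] (mem X e × ℓ e ≡ a × Sat X (ρ [ x ↦ e ]) φ)
  Sat X ρ (⟪ x ⟫ φ) =
    Σ[ X' ∈ Conf ] Σ[ e ∈ Ev ] (Step X' e X × ρ x ≡ just e × Permissible ρ φ X' × Sat X' ρ φ)

  Models : Form Act → Set
  Models φ = Σ[ X ∈ Conf ] (IsEmpty X × Sat X emptyEnv φ)

EquivHwh : {Act : Set} → ConfStruct Act → ConfStruct Act → Set
EquivHwh {Act} C D = (φ : Form Act) → Hwh φ → Closed φ → (Models C φ ⇔ Models D φ)

-- Soundness (`transfer`): along an HWH bisimulation, satisfaction of an
-- EIL_hwh formula is transferred under environments that name f-related
-- events; negation is handled by transposing the bisimulation.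
--
-- Completeness: relate X, Y, f when f : X ≅ Y and X, Y satisfy the same
-- formulas under f-corresponding environments (`Related`).  Backward steps
-- are matched with ⟨⟨x⟩⟩φ, x fresh (`related-bwd`).  For a forward step
-- X -a-> X' enumerate X' along an unwinding to ∅ and let identifier i name
-- its i-th event.  Undoing-formulas ⟨⟨x₁⟩⟩…⟨⟨xₖ⟩⟩φ transfer enumerations and
-- (in)dependence of events (`Reflection`), so a successor of Y agreeing
-- with X' on all such "bounded" formulas yields an isomorphism
-- (`IndexCorrespondence`, renaming identifiers to positions); by image
-- finiteness such a successor exists, for otherwise a single characteristic
-- formula ⟨a⟩(0:a₀)…(n-1:aₙ₋₁)Ψ separates X from Y (`Forward`).

module Submission where

open import Defs
open import Level using (0ℓ)
open import Axiom.ExcludedMiddle using (ExcludedMiddle)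
open import Function.Base using (_∘_)
open import Function.Bundles using (_⇔_; mk⇔; Equivalence)
open import Function.Construct.Symmetry using (⇔-sym)
open import Function.Construct.Composition using () renaming (equivalence to ⇔-trans)
open import Data.Nat using (ℕ; zero; suc; _+_; _⊔_; _≟_; _<_; _≤_; z≤n; s≤s)
open import Data.Nat.Properties using (m≤m⊔n; m≤n⊔m; ≤-trans; ≤-refl; ≤-pred; <-irrefl; n≮0; ≤∧≢⇒<; m≤n⇒m≤1+n; <⇒≢; +-identityʳ; +-suc)
open import Data.List using (List; []; _∷_; _++_; foldr; map; filter; length; applyUpTo; upTo; cartesianProductWith)
open import Data.List.Properties using (filter-notAll; length-map)
open import Data.List.Membership.DecPropositional _≟_ using (_∈?_)
open import Data.List.Membership.Propositional using (_∈_)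
open import Data.List.Membership.Propositional.Properties using (∈-upTo⁻; ∈-++⁺ˡ; ∈-++⁺ʳ; ∈-++⁻; ∈-map⁺; ∈-filter⁺; ∈-cartesianProductWith⁺)
open import Data.List.Relation.Unary.Any as Any using (here; there)
open import Data.List.Relation.Unary.All as All using (All; []; _∷_)
open import Data.List.Relation.Binary.Pointwise using (Pointwise; []; _∷_; Pointwise-length)
open import Data.Maybe using (Maybe; just; nothing)
open import Data.Maybe.Properties using (just-injective)
open import Data.Product using (Σ-syntax; _×_; _,_; proj₁; proj₂)
open import Data.Sum using (_⊎_; inj₁; inj₂; [_,_])
open import Data.Empty using (⊥; ⊥-elim)
open import Data.Unit using (tt)
open import Relation.Nullary using (¬_; yes; no; Dec; ¬?)
open import Relation.Binary.PropositionalEquality using (_≡_; _≢_; refl; sym; trans; cong; cong₂; subst)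

∈-removeId⁻ : ∀ {z x} L → z ∈ removeId x L → z ∈ L × z ≢ x
∈-removeId⁻ {z} {x} (y ∷ ys) p with y ≟ x
... | yes _ = let (q , z≢x) = ∈-removeId⁻ ys p in there q , z≢x
∈-removeId⁻ {z} {x} (y ∷ ys) (here refl) | no y≢x = here refl , y≢x
∈-removeId⁻ {z} {x} (y ∷ ys) (there p)   | no _   = let (q , z≢x) = ∈-removeId⁻ ys p in there q , z≢x

∈-removeId⁺ : ∀ {z x} L → z ∈ L → z ≢ x → z ∈ removeId x L
∈-removeId⁺ {z} {x} (y ∷ ys) p z≢x with y ≟ x
∈-removeId⁺ (y ∷ ys) (here refl) z≢x | yes y≡x = ⊥-elim (z≢x y≡x)
∈-removeId⁺ (y ∷ ys) (there p)   z≢x | yes _   = ∈-removeId⁺ ys p z≢x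
∈-removeId⁺ (y ∷ ys) (here refl) z≢x | no _    = here refl
∈-removeId⁺ (y ∷ ys) (there p)   z≢x | no _    = there (∈-removeId⁺ ys p z≢x)

-- Identifier equality as a sum.  Case splits on it do not abstract the
-- `_≟_` tests hidden inside environment updates occurring in the goal.
≡-or-≢ : (y x : Id) → y ≡ x ⊎ y ≢ x
≡-or-≢ y x with y ≟ x
... | yes p = inj₁ p
... | no p  = inj₂ p

closed-∉ : ∀ {Act} {φ : Form Act} {y} → Closed φ → ¬ y ∈ fi φ
closed-∉ cl p with subst (_ ∈_) cl p
... | ()

closed-intro : ∀ {Act} (φ : Form Act) → (∀ y → ¬ y ∈ fi φ) → Closed φ
closed-intro φ none with fi φ
... | []    = refl
... | y ∷ _ = ⊥-elim (none y (here refl))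

maxId : List Id → Id
maxId = foldr _⊔_ 0

fresh : List Id → Id
fresh L = suc (maxId L)

fresh-≢ : ∀ {x} L → x ∈ L → x ≢ fresh L
fresh-≢ L p refl = <-irrefl refl (s≤s (below L p))
  where
    below : ∀ {x} L → x ∈ L → x ≤ maxId L
    below (y ∷ L) (here refl) = m≤m⊔n y (maxId L)
    below (y ∷ L) (there p)   = ≤-trans (below L p) (m≤n⊔m y (maxId L))

module Coincidence {Act : Set} (C : ConfStruct Act) where
  open ConfStruct C

  upd : Env C → Id → Ev → Env C
  upd = _[_↦_] C

  upd-eq : ∀ ρ x e → upd ρ x e x ≡ just e
  upd-eq ρ x e with x ≟ x
  ... | yes _ = refl
  ... | no x≢x = ⊥-elim (x≢x refl)

  upd-neq : ∀ ρ x e y → y ≢ x → upd ρ x e y ≡ ρ y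
  upd-neq ρ x e y y≢x with y ≟ x
  ... | yes y≡x = ⊥-elim (y≢x y≡x)
  ... | no _ = refl

  Agree : Env C → Env C → Form Act → Set
  Agree ρ ρ' φ = ∀ x → x ∈ fi φ → ρ x ≡ ρ' x

  agree-bind : ∀ {ρ ρ'} x e φ → Agree ρ ρ' (⦅ x ∶ ℓ e ⦆ φ) →
               Agree (upd ρ x e) (upd ρ' x e) φ
  agree-bind {ρ} {ρ'} x e φ ag y p with ≡-or-≢ y x
  ... | inj₁ refl = trans (upd-eq ρ y e) (sym (upd-eq ρ' y e))
  ... | inj₂ y≢x  = trans (upd-neq ρ x e y y≢x)
                      (trans (ag y (∈-removeId⁺ (fi φ) p y≢x)) (sym (upd-neq ρ' x e y y≢x)))

  coincide : ∀ φ {X ρ ρ'} → Agree ρ ρ' φ → Sat C X ρ φ → Sat C X ρ' φ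
  coincide tt ag s = s
  coincide (¬' φ) ag s s' = s (coincide φ (λ x p → sym (ag x p)) s')
  coincide (φ ∧' ψ) ag (s , t) =
    coincide φ (λ x p → ag x (∈-++⁺ˡ p)) s , coincide ψ (λ x p → ag x (∈-++⁺ʳ (fi φ) p)) t
  coincide (⟨ x ∶ a ⟩ φ) ag (X' , e , st , l , s) = X' , e , st , l , coincide φ (agree-bind x e φ ag) s
  coincide (⦅ x ∶ a ⦆ φ) ag (e , m , l , s) = e , m , l , coincide φ (agree-bind x e φ ag) s
  coincide (⟪ x ⟫ φ) ag (X' , e , st , ρx , perm , s) =
    X' , e , st , trans (sym (ag x (∈-++⁺ʳ (fi φ) (here refl)))) ρx ,
    (λ y p → let (d , ρy , m) = perm y p in d , trans (sym (ag y (∈-++⁺ˡ p))) ρy , m) ,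
    coincide φ (λ y p → ag y (∈-++⁺ˡ p)) s

  coincide⇔ : ∀ φ {X ρ ρ'} → Agree ρ ρ' φ → Sat C X ρ φ ⇔ Sat C X ρ' φ
  coincide⇔ φ ag = mk⇔ (coincide φ ag) (coincide φ (λ x p → sym (ag x p)))

  closed-coincide : ∀ {φ X ρ ρ'} → Closed φ → Sat C X ρ φ → Sat C X ρ' φ
  closed-coincide {φ} cl = coincide φ (λ y p → ⊥-elim (closed-∉ {φ = φ} cl p))

  empty-unique : ∀ {X X'} → IsEmpty X → IsEmpty X' → X ≡ X'
  empty-unique {X} {X'} empX empX' =
    conf-ext X X' (λ e → mk⇔ (λ m → ⊥-elim (empX e m)) (λ m → ⊥-elim (empX' e m)))

  pred-unique : ∀ {W W' e X} → Step W e X → Step W' e X → W ≡ W'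
  pred-unique {W} {W'} {X = X} (sub , _ , ¬m , cov) (sub' , _ , ¬m' , cov') =
    conf-ext W W' (λ d → mk⇔ (into cov' sub ¬m d) (into cov sub' ¬m' d))
    where
      into : ∀ {V V' e} → (∀ d → mem X d → mem V' d ⊎ d ≡ e) → V ⊆ X → ¬ mem V e →
             ∀ d → mem V d → mem V' d
      into cov'' sub'' ¬me d m with cov'' d (sub'' d m)
      ... | inj₁ m' = m'
      ... | inj₂ refl = ⊥-elim (¬me m)

  undo-determined : ∀ {X'' e X ρ x φ} → Step X'' e X → ρ x ≡ just e →
                    Sat C X ρ (⟪ x ⟫ φ) → Sat C X'' ρ φ
  undo-determined {ρ = ρ} {φ = φ} st ρx (W , e' , st' , ρx' , _ , s)
    with just-injective (trans (sym ρx) ρx')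
  ... | refl = subst (λ V → Sat C V ρ φ) (pred-unique st' st) s

-- Renaming identifiers.  `rename r φ` sends every free identifier y of φ to
-- r y and renames every binder to an identifier fresh for the renamed free
-- identifiers of its body, so that no capture occurs.

redirect : (Id → Id) → Id → Id → (Id → Id)
redirect r x c y with y ≟ x
... | yes _ = c
... | no _  = r y

redirect-eq : ∀ r x c → redirect r x c x ≡ c
redirect-eq r x c with x ≟ x
... | yes _ = refl
... | no x≢x = ⊥-elim (x≢x refl)

redirect-neq : ∀ r x c y → y ≢ x → redirect r x c y ≡ r y
redirect-neq r x c y y≢x with y ≟ x
... | yes y≡x = ⊥-elim (y≢x y≡x)
... | no _ = refl

module _ {Act : Set} where
  freshFor : (Id → Id) → Form Act → Id
  freshFor r φ = fresh (map r (fi φ))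

  freshFor-≢ : ∀ r φ {y} → y ∈ fi φ → r y ≢ freshFor r φ
  freshFor-≢ r φ p = fresh-≢ (map r (fi φ)) (∈-map⁺ r p)

  under : (Id → Id) → Id → Form Act → (Id → Id)
  under r x φ = redirect r x (freshFor r φ)

  rename : (Id → Id) → Form Act → Form Act
  rename r tt = tt
  rename r (¬' φ) = ¬' rename r φ
  rename r (φ ∧' ψ) = rename r φ ∧' rename r ψ
  rename r (⟨ x ∶ a ⟩ φ) = ⟨ freshFor r φ ∶ a ⟩ rename (under r x φ) φ
  rename r (⦅ x ∶ a ⦆ φ) = ⦅ freshFor r φ ∶ a ⦆ rename (under r x φ) φ
  rename r (⟪ x ⟫ φ) = ⟪ r x ⟫ rename r φ

  fi-rename⁻ : ∀ r φ {z} → z ∈ fi (rename r φ) → Σ[ y ∈ Id ] (y ∈ fi φ × r y ≡ z)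

  fi-rename⁻-binder : ∀ r x φ {z} → z ∈ removeId (freshFor r φ) (fi (rename (under r x φ) φ)) →
                      Σ[ y ∈ Id ] (y ∈ removeId x (fi φ) × r y ≡ z)
  fi-rename⁻-binder r x φ p with ∈-removeId⁻ _ p
  ... | q , z≢c with fi-rename⁻ (under r x φ) φ q
  ... | y , y∈ , eq with ≡-or-≢ y x
  ... | inj₁ refl = ⊥-elim (z≢c (trans (sym eq) (redirect-eq r y (freshFor r φ))))
  ... | inj₂ y≢x  = y , ∈-removeId⁺ (fi φ) y∈ y≢x , trans (sym (redirect-neq r x (freshFor r φ) y y≢x)) eq

  fi-rename⁻ r tt ()
  fi-rename⁻ r (¬' φ) p = fi-rename⁻ r φ p
  fi-rename⁻ r (φ ∧' ψ) p with ∈-++⁻ (fi (rename r φ)) p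
  ... | inj₁ q = let (y , y∈ , eq) = fi-rename⁻ r φ q in y , ∈-++⁺ˡ y∈ , eq
  ... | inj₂ q = let (y , y∈ , eq) = fi-rename⁻ r ψ q in y , ∈-++⁺ʳ (fi φ) y∈ , eq
  fi-rename⁻ r (⟨ x ∶ a ⟩ φ) p = fi-rename⁻-binder r x φ p
  fi-rename⁻ r (⦅ x ∶ a ⦆ φ) p = fi-rename⁻-binder r x φ p
  fi-rename⁻ r (⟪ x ⟫ φ) p with ∈-++⁻ (fi (rename r φ)) p
  ... | inj₁ q = let (y , y∈ , eq) = fi-rename⁻ r φ q in y , ∈-++⁺ˡ y∈ , eq
  ... | inj₂ (here refl) = x , ∈-++⁺ʳ (fi φ) (here refl) , refl

  fi-rename⁺ : ∀ r φ {y} → y ∈ fi φ → r y ∈ fi (rename r φ)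

  fi-rename⁺-binder : ∀ r x φ {y} → y ∈ removeId x (fi φ) →
                      r y ∈ removeId (freshFor r φ) (fi (rename (under r x φ) φ))
  fi-rename⁺-binder r x φ {y} p with ∈-removeId⁻ (fi φ) p
  ... | q , y≢x = ∈-removeId⁺ _
        (subst (_∈ _) (redirect-neq r x (freshFor r φ) y y≢x) (fi-rename⁺ (under r x φ) φ q))
        (freshFor-≢ r φ q)

  fi-rename⁺ r tt ()
  fi-rename⁺ r (¬' φ) p = fi-rename⁺ r φ p
  fi-rename⁺ r (φ ∧' ψ) p with ∈-++⁻ (fi φ) p
  ... | inj₁ q = ∈-++⁺ˡ (fi-rename⁺ r φ q)
  ... | inj₂ q = ∈-++⁺ʳ (fi (rename r φ)) (fi-rename⁺ r ψ q)
  fi-rename⁺ r (⟨ x ∶ a ⟩ φ) p = fi-rename⁺-binder r x φ p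
  fi-rename⁺ r (⦅ x ∶ a ⦆ φ) p = fi-rename⁺-binder r x φ p
  fi-rename⁺ r (⟪ x ⟫ φ) p with ∈-++⁻ (fi φ) p
  ... | inj₁ q = ∈-++⁺ˡ (fi-rename⁺ r φ q)
  ... | inj₂ (here refl) = ∈-++⁺ʳ (fi (rename r φ)) (here refl)

  closed-rename : ∀ r φ → Closed φ → Closed (rename r φ)
  closed-rename r φ cl = closed-intro (rename r φ)
    (λ z p → let (y , y∈ , _) = fi-rename⁻ r φ p in closed-∉ {φ = φ} cl y∈)

  hwh-rename : ∀ r {φ} → Hwh φ → Hwh (rename r φ)
  hwh-rename r h-tt = h-tt
  hwh-rename r (h-neg h) = h-neg (hwh-rename r h)
  hwh-rename r (h-and h h') = h-and (hwh-rename r h) (hwh-rename r h')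
  hwh-rename r (h-diam {φ = φ} cl h) = h-diam (closed-rename _ φ cl) (hwh-rename _ h)
  hwh-rename r (h-has h) = h-has (hwh-rename _ h)
  hwh-rename r (h-rev h) = h-rev (hwh-rename r h)

module Renaming {Act : Set} (C : ConfStruct Act) where
  open ConfStruct C
  open Coincidence C

  agree-under : ∀ r x φ ρ e → Agree (upd ρ (freshFor r φ) e ∘ under r x φ) (upd (ρ ∘ r) x e) φ
  agree-under r x φ ρ e y p with ≡-or-≢ y x
  ... | inj₁ refl = trans (cong (upd ρ (freshFor r φ) e) (redirect-eq r y (freshFor r φ)))
                      (trans (upd-eq ρ (freshFor r φ) e) (sym (upd-eq (ρ ∘ r) y e)))
  ... | inj₂ y≢x  = trans (cong (upd ρ (freshFor r φ) e) (redirect-neq r x (freshFor r φ) y y≢x))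
                      (trans (upd-neq ρ (freshFor r φ) e (r y) (freshFor-≢ r φ p))
                        (sym (upd-neq (ρ ∘ r) x e y y≢x)))

  permissible-rename : ∀ r φ ρ W → Permissible C ρ (rename r φ) W ⇔ Permissible C (ρ ∘ r) φ W
  permissible-rename r φ ρ W = mk⇔
    (λ perm y p → perm (r y) (fi-rename⁺ r φ p))
    (λ perm z q → let (y , y∈ , eq) = fi-rename⁻ r φ q in
      subst (λ w → Σ[ e ∈ Ev ] (ρ w ≡ just e × mem W e)) eq (perm y y∈))

  sat-rename : ∀ φ r {X ρ} → Sat C X ρ (rename r φ) ⇔ Sat C X (ρ ∘ r) φ
  sat-rename tt r = mk⇔ (λ s → s) (λ s → s)
  sat-rename (¬' φ) r = mk⇔ (λ ns s → ns (Equivalence.from (sat-rename φ r) s))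
                            (λ ns s → ns (Equivalence.to (sat-rename φ r) s))
  sat-rename (φ ∧' ψ) r =
    mk⇔ (λ (s , t) → Equivalence.to (sat-rename φ r) s , Equivalence.to (sat-rename ψ r) t)
        (λ (s , t) → Equivalence.from (sat-rename φ r) s , Equivalence.from (sat-rename ψ r) t)
  sat-rename (⟨ x ∶ a ⟩ φ) r {X} {ρ} = mk⇔
    (λ (X' , e , st , l , s) → X' , e , st , l , Equivalence.to (body e) s)
    (λ (X' , e , st , l , s) → X' , e , st , l , Equivalence.from (body e) s)
    where
      body : ∀ {X'} e → Sat C X' (upd ρ (freshFor r φ) e) (rename (under r x φ) φ) ⇔
                         Sat C X' (upd (ρ ∘ r) x e) φ
      body e = ⇔-trans (sat-rename φ (under r x φ)) (coincide⇔ φ (agree-under r x φ ρ e))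
  sat-rename (⦅ x ∶ a ⦆ φ) r {X} {ρ} = mk⇔
    (λ (e , m , l , s) → e , m , l , Equivalence.to (body e) s)
    (λ (e , m , l , s) → e , m , l , Equivalence.from (body e) s)
    where
      body : ∀ e → Sat C X (upd ρ (freshFor r φ) e) (rename (under r x φ) φ) ⇔
                    Sat C X (upd (ρ ∘ r) x e) φ
      body e = ⇔-trans (sat-rename φ (under r x φ)) (coincide⇔ φ (agree-under r x φ ρ e))
  sat-rename (⟪ x ⟫ φ) r {X} {ρ} = mk⇔
    (λ (X' , e , st , ρx , perm , s) → X' , e , st , ρx ,
       Equivalence.to (permissible-rename r φ ρ X') perm , Equivalence.to (sat-rename φ r) s)
    (λ (X' , e , st , ρx , perm , s) → X' , e , st , ρx ,
       Equivalence.from (permissible-rename r φ ρ X') perm , Equivalence.from (sat-rename φ r) s)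

module _ {Act : Set} (C D : ConfStruct Act) where
  private
    module C = ConfStruct C
    module D = ConfStruct D

  Corr : Rel C D → Env C → Env D → Form Act → Set
  Corr f ρ σ φ = ∀ x → x ∈ fi φ →
    Σ[ d ∈ C.Ev ] Σ[ e ∈ D.Ev ] (ρ x ≡ just d × σ x ≡ just e × f d e)

  corr-bind : ∀ {f ρ σ} x a φ {d e} → Corr f ρ σ (⦅ x ∶ a ⦆ φ) → f d e →
              Corr f (Coincidence.upd C ρ x d) (Coincidence.upd D σ x e) φ
  corr-bind {f} {ρ} {σ} x a φ {d} {e} c fde y p with ≡-or-≢ y x
  ... | inj₁ refl = d , e , Coincidence.upd-eq C ρ y d , Coincidence.upd-eq D σ y e , fde
  ... | inj₂ y≢x  = let (d' , e' , ρy , σy , fd'e') = c y (∈-removeId⁺ (fi φ) p y≢x) in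
    d' , e' , trans (Coincidence.upd-neq C ρ x d y y≢x) ρy ,
    trans (Coincidence.upd-neq D σ x e y y≢x) σy , fd'e'

  corr-closed : ∀ {f ρ σ φ} → Closed φ → Corr f ρ σ φ
  corr-closed {φ = φ} cl y p = ⊥-elim (closed-∉ {φ = φ} cl p)

transpose : ∀ {A B : Set} → (A → B → Set) → (B → A → Set)
transpose f e d = f d e

module _ {Act : Set} {C D : ConfStruct Act} where
  private
    module C = ConfStruct C
    module D = ConfStruct D

  corr-transpose : ∀ {f ρ σ} φ → Corr C D f ρ σ φ → Corr D C (transpose f) σ ρ φ
  corr-transpose φ c x p = let (d , e , ρx , σx , fde) = c x p in e , d , σx , ρx , fde

  iso-transpose : ∀ {X Y f} → Iso C D X Y f → Iso D C Y X (transpose f)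
  iso-transpose I = record
    { dom⊆ = λ e d p → let (mX , mY) = dom⊆ d e p in mY , mX
    ; total = surj
    ; func = λ e d d' p q → inj d d' e p q
    ; inj = λ e e' d p q → func d e e' p q
    ; surj = total
    ; label = λ e d p → sym (label d e p)
    ; order = λ e e' d d' p q → ⇔-sym (order d d' e e' p q) }
    where open Iso I

  restricts-transpose : ∀ {X Y f X' Y' f'} → Iso C D X Y f → Iso C D X' Y' f' →
                        Restricts C D f X' f' → Restricts D C (transpose f) Y' (transpose f')
  restricts-transpose {f = f} {X'} {Y'} {f'} I I' res e d = mk⇔ to from
    where
      to : f' d e → f d e × D.mem Y' e
      to p = proj₁ (Equivalence.to (res d e) p) , proj₂ (Iso.dom⊆ I' d e p)
      from : f d e × D.mem Y' e → f' d e
      from (p , m) with Iso.surj I' e m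
      ... | d₀ , q with Iso.inj I d₀ d e (proj₁ (Equivalence.to (res d₀ e) q)) p
      ... | refl = q

  transposeRel : (C.Conf → D.Conf → Rel C D → Set) → (D.Conf → C.Conf → Rel D C → Set)
  transposeRel R Y X g = R X Y (transpose g)

  hwh-transpose : ∀ {R} → IsHWH C D R → IsHWH D C (transposeRel R)
  hwh-transpose {R} H = record
    { iso = λ Y X g r → iso-transpose (iso X Y (transpose g) r)
    ; fwdC = λ Y X g a Y' r st → let (X' , f' , st' , r') = fwdD X Y (transpose g) a Y' r st in
        X' , transpose f' , st' , r'
    ; fwdD = λ Y X g a X' r st → let (Y' , f' , st' , r') = fwdC X Y (transpose g) a X' r st in
        Y' , transpose f' , st' , r'
    ; bwdC = λ Y X g a Y' r st → let (X' , f' , st' , r' , res) = bwdD X Y (transpose g) a Y' r st in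
        X' , transpose f' , st' , r' ,
        restricts-transpose (iso X Y (transpose g) r) (iso X' Y' f' r') res
    ; bwdD = λ Y X g a X' r st → let (Y' , f' , st' , r' , res) = bwdC X Y (transpose g) a X' r st in
        Y' , transpose f' , st' , r' ,
        restricts-transpose (iso X Y (transpose g) r) (iso X' Y' f' r') res }
    where open IsHWH H

removed-image : ∀ {Act} {C D : ConfStruct Act} {X Y f X'' Y'' f' e e' e₂} →
  Iso C D X Y f → Iso C D X'' Y'' f' → Restricts C D f X'' f' →
  ConfStruct.Step C X'' e X → ConfStruct.Step D Y'' e₂ Y → f e e' → e' ≡ e₂
removed-image {e = e} {e'} I I' res (_ , _ , ¬me , _) (_ , _ , _ , cov) fee'
  with cov e' (proj₂ (Iso.dom⊆ I e e' fee'))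
... | inj₂ eq = eq
... | inj₁ m with Iso.surj I' e' m
... | d₀ , f'd₀ with Equivalence.to (res d₀ e') f'd₀
... | fd₀ , md₀ with Iso.inj I d₀ e e' fd₀ fee'
... | refl = ⊥-elim (¬me md₀)

-- the transfer lemma, by induction on φ (⟨a⟩ needs only closed bodies,
-- ⟨⟨x⟩⟩ uses that the undone event is the f-image of ρ x)
transfer : ∀ {Act} (φ : Form Act) → Hwh φ → ∀ {C D : ConfStruct Act} R → IsHWH C D R →
           ∀ {X Y f ρ σ} → R X Y f → Corr C D f ρ σ φ → Sat C X ρ φ → Sat D Y σ φ
transfer tt h-tt R H r c s = s
transfer (¬' φ) (h-neg h) {C} {D} R H r c ns s =
  ns (transfer φ h (transposeRel {C = C} {D} R) (hwh-transpose H) r (corr-transpose {C = C} {D} φ c) s)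
transfer (φ ∧' ψ) (h-and h h') R H r c (s , t) =
  transfer φ h R H r (λ x p → c x (∈-++⁺ˡ p)) s , transfer ψ h' R H r (λ x p → c x (∈-++⁺ʳ (fi φ) p)) t
transfer (⟨ x ∶ a ⟩ φ) (h-diam cl h) {C} {D} R H {X} {Y} {f} r c (X' , e , st , l , s) =
  let (Y' , f' , (e' , st' , l') , r') = IsHWH.fwdC H X Y f a X' r (e , st , l)
  in Y' , e' , st' , l' , transfer φ h R H r' (corr-closed C D {φ = φ} cl) s
transfer (⦅ x ∶ a ⦆ φ) (h-has h) {C} {D} R H {X} {Y} {f} r c (e , m , l , s) =
  e' , proj₂ (Iso.dom⊆ I e e' fee') , trans (sym (Iso.label I e e' fee')) l ,
  transfer φ h R H r (corr-bind C D x a φ c fee') s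
  where
    I : Iso C D X Y f
    I = IsHWH.iso H X Y f r
    e' : ConfStruct.Ev D
    e' = proj₁ (Iso.total I e m)
    fee' : f e e'
    fee' = proj₂ (Iso.total I e m)
transfer (⟪ x ⟫ φ) (h-rev h) {C} {D} R H {X} {Y} {f} {ρ} {σ} r c (X'' , e , st , ρx , perm , s)
  with c x (∈-++⁺ʳ (fi φ) (here refl))
... | d , e' , ρx' , σx , fde' with just-injective (trans (sym ρx') ρx)
... | refl with IsHWH.bwdC H X Y f (ConfStruct.ℓ C d) X'' r (d , st , refl)
... | Y'' , f' , (e₂ , st₂ , _) , r' , res =
  Y'' , e₂ , st₂ , trans σx (cong just (removed-image I I' res st st₂ fde')) , perm' ,
  transfer φ h R H r' c' s
  where
    I : Iso C D X Y f
    I = IsHWH.iso H X Y f r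
    I' : Iso C D X'' Y'' f'
    I' = IsHWH.iso H X'' Y'' f' r'
    c' : Corr C D f' ρ σ φ
    c' y q with c y (∈-++⁺ˡ q) | perm y q
    ... | d₁ , e₁ , ρy , σy , f₁ | d₂ , ρy' , m₂ with just-injective (trans (sym ρy) ρy')
    ... | refl = d₁ , e₁ , ρy , σy , Equivalence.from (res d₁ e₁) (f₁ , m₂)
    perm' : Permissible D σ φ Y''
    perm' y q = let (d₁ , e₁ , _ , σy , f₁) = c' y q in e₁ , σy , proj₂ (Iso.dom⊆ I' d₁ e₁ f₁)

soundness : ∀ {Act} (C D : ConfStruct Act) → HWHBisimilar C D → EquivHwh C D
soundness C D (R , H , X₀ , Y₀ , empX₀ , empY₀ , r₀) φ h cl = mk⇔ to from
  where
    to : Models C φ → Models D φ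
    to (X , empX , s) rewrite Coincidence.empty-unique C empX empX₀ =
      Y₀ , empY₀ , transfer φ h R H r₀ (corr-closed C D {φ = φ} cl) s
    from : Models D φ → Models C φ
    from (Y , empY , s) rewrite Coincidence.empty-unique D empY empY₀ =
      X₀ , empX₀ , transfer φ h (transposeRel {C = C} {D} R) (hwh-transpose H) r₀ (corr-closed D C {φ = φ} cl) s

-- Positional lookup in lists.  In the completeness proof identifier i names
-- the i-th event of an enumeration of a configuration.

nth : ∀ {A : Set} → List A → ℕ → Maybe A
nth [] i = nothing
nth (x ∷ xs) zero = just x
nth (x ∷ xs) (suc i) = nth xs i

nth-∈ : ∀ {A : Set} (xs : List A) i {d} → nth xs i ≡ just d → d ∈ xs
nth-∈ (x ∷ xs) zero refl = here refl
nth-∈ (x ∷ xs) (suc i) p = there (nth-∈ xs i p)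

∈-nth : ∀ {A : Set} (xs : List A) {d} → d ∈ xs → Σ[ i ∈ ℕ ] (nth xs i ≡ just d)
∈-nth (x ∷ xs) (here refl) = 0 , refl
∈-nth (x ∷ xs) (there p) = let (i , q) = ∈-nth xs p in suc i , q

nth-< : ∀ {A : Set} (xs : List A) i {d} → nth xs i ≡ just d → i < length xs
nth-< (x ∷ xs) zero p = s≤s z≤n
nth-< (x ∷ xs) (suc i) p = s≤s (nth-< xs i p)

nth-defined : ∀ {A : Set} (xs : List A) i → i < length xs → Σ[ d ∈ A ] nth xs i ≡ just d
nth-defined (x ∷ xs) zero p = x , refl
nth-defined (x ∷ xs) (suc i) (s≤s p) = nth-defined xs i p

module Unwindings {Act : Set} (C : ConfStruct Act) where
  open ConfStruct C

  data Unwinding : Conf → List Ev → Conf → Set where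
    done : ∀ {X} → Unwinding X [] X
    undo : ∀ {X X' e rs W} → Step X' e X → Unwinding X' rs W → Unwinding X (e ∷ rs) W

  unwinding-⊆ : ∀ {X rs W} → Unwinding X rs W → W ⊆ X
  unwinding-⊆ done d m = m
  unwinding-⊆ (undo (sub , _) u) d m = sub d (unwinding-⊆ u d m)

  unwinding-covers : ∀ {X rs W} → Unwinding X rs W → ∀ d → mem X d → d ∈ rs ⊎ mem W d
  unwinding-covers done d m = inj₂ m
  unwinding-covers (undo (_ , _ , _ , cov) u) d m with cov d m
  ... | inj₂ refl = inj₁ (here refl)
  ... | inj₁ m' with unwinding-covers u d m'
  ... | inj₁ p = inj₁ (there p)
  ... | inj₂ q = inj₂ q

  unwinding-removed : ∀ {X rs W} → Unwinding X rs W → ∀ {d} → d ∈ rs → mem X d × ¬ mem W d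
  unwinding-removed (undo (_ , me , ¬me , _) u) (here refl) = me , (λ w → ¬me (unwinding-⊆ u _ w))
  unwinding-removed (undo (sub , _) u) (there p) = let (m , ¬w) = unwinding-removed u p in sub _ m , ¬w

  unwinding-distinct : ∀ {X rs W} → Unwinding X rs W → ∀ i j {d} → nth rs i ≡ just d → nth rs j ≡ just d → i ≡ j
  unwinding-distinct (undo st u) zero zero p q = refl
  unwinding-distinct (undo (_ , _ , ¬me , _) u) zero (suc j) refl q =
    ⊥-elim (¬me (proj₁ (unwinding-removed u (nth-∈ _ j q))))
  unwinding-distinct (undo (_ , _ , ¬me , _) u) (suc i) zero p refl =
    ⊥-elim (¬me (proj₁ (unwinding-removed u (nth-∈ _ i p))))
  unwinding-distinct (undo st u) (suc i) (suc j) p q = cong suc (unwinding-distinct u i j p q)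

  Enumeration : Conf → List Ev → Set
  Enumeration V vs = Σ[ Z ∈ Conf ] (IsEmpty Z × Unwinding V vs Z)

  enum-listed : ∀ {V vs d} → Enumeration V vs → mem V d → d ∈ vs
  enum-listed (Z , empZ , u) m with unwinding-covers u _ m
  ... | inj₁ d∈ = d∈
  ... | inj₂ z = ⊥-elim (empZ _ z)

  enum-member : ∀ {V vs d} → Enumeration V vs → d ∈ vs → mem V d
  enum-member (Z , empZ , u) d∈ = proj₁ (unwinding-removed u d∈)

  enum-distinct : ∀ {V vs} → Enumeration V vs → ∀ i j {d} → nth vs i ≡ just d → nth vs j ≡ just d → i ≡ j
  enum-distinct (Z , empZ , u) = unwinding-distinct u

module StableUnwinding {Act : Set} (lem : ExcludedMiddle 0ℓ) (C : ConfStruct Act) (St : Stable C) where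
  open ConfStruct C
  open Stable St
  open Unwindings C

  _≟ₑ_ : (a b : Ev) → Dec (a ≡ b)
  a ≟ₑ b = lem

  without : Ev → List Ev → List Ev
  without e = filter (λ k → ¬? (k ≟ₑ e))

  without-shorter : ∀ e ks → e ∈ ks → length (without e ks) < length ks
  without-shorter e ks e∈ = filter-notAll (λ k → ¬? (k ≟ₑ e)) ks (Any.map (λ e≡k k≢e → k≢e (sym e≡k)) e∈)

  ∈-without : ∀ e ks {d} → d ∈ ks → d ≢ e → d ∈ without e ks
  ∈-without e ks = ∈-filter⁺ (λ k → ¬? (k ≟ₑ e))

  rooted-step : ∀ {X X' e} → mem X e → (∀ d → mem X' d ⇔ (mem X d × d ≢ e)) → Step X' e X
  rooted-step {X} {X'} {e} me eqv =
    (λ d m → proj₁ (Equivalence.to (eqv d) m)) , me ,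
    (λ m → proj₂ (Equivalence.to (eqv e) m) refl) , kept-or-e
    where
      kept-or-e : ∀ d → mem X d → mem X' d ⊎ d ≡ e
      kept-or-e d m with d ≟ₑ e
      ... | yes d≡e = inj₂ d≡e
      ... | no d≢e  = inj₁ (Equivalence.from (eqv d) (m , d≢e))

  unwind-to-empty′ : ∀ n {X} ks → length ks ≤ n → (∀ d → mem X d → d ∈ ks) →
                     Σ[ rs ∈ List Ev ] Σ[ Z ∈ Conf ] (IsEmpty Z × Unwinding X rs Z)
  unwind-to-empty′ n {X} ks len cover with lem {Σ[ e ∈ Ev ] mem X e}
  ... | no none = [] , X , (λ e m → none (e , m)) , done
  ... | yes nonempty with rooted X nonempty | n
  ... | e , me , X' , eqv | zero = ⊥-elim (n≮0 (≤-trans (without-shorter e ks (cover e me)) len))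
  ... | e , me , X' , eqv | suc n' =
    let (rs , Z , empZ , u) = unwind-to-empty′ n' (without e ks)
          (≤-pred (≤-trans (without-shorter e ks (cover e me)) len))
          (λ d m → let (mX , d≢e) = Equivalence.to (eqv d) m in ∈-without e ks (cover d mX) d≢e)
    in e ∷ rs , Z , empZ , undo (rooted-step me eqv) u

  unwind-to-empty : ∀ X → Σ[ rs ∈ List Ev ] Σ[ Z ∈ Conf ] (IsEmpty Z × Unwinding X rs Z)
  unwind-to-empty X = let (ks , eqv) = conf-fin X in
    unwind-to-empty′ (length ks) ks ≤-refl (λ d m → Equivalence.to (eqv d) m)

  -- Unwinding to W ⊆ X, by induction along an unwinding of some X' ⊆ X to ∅
  -- with X ⊆ W ∪ X': removed events outside W are removed from W ∪ X'.
  unwind-along : ∀ {X' rs Z} → Unwinding X' rs Z → IsEmpty Z → ∀ {X W} → W ⊆ X → X' ⊆ X →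
                 (∀ d → mem X d → mem W d ⊎ mem X' d) → Σ[ us ∈ List Ev ] Unwinding X us W
  unwind-along done empZ {X} {W} WX _ cover = [] , subst (Unwinding X []) (conf-ext X W X≡W) done
    where
      X≡W : ∀ d → mem X d ⇔ mem W d
      X≡W d = mk⇔ (λ m → [ (λ w → w) , (λ z → ⊥-elim (empZ d z)) ] (cover d m)) (WX d)
  unwind-along (undo {X = X'} {X'' } {r} (sub , mr , ¬mr , cov) u) empZ {X} {W} WX X'X cover
    with union∈ W X'' X WX (λ d m → X'X d (sub d m)) | lem {mem W r}
  ... | V , eqv | yes wr = unwind-along u empZ WX (λ d m → X'X d (sub d m)) cover'
    where
      cover' : ∀ d → mem X d → mem W d ⊎ mem X'' d
      cover' d m with cover d m
      ... | inj₁ w = inj₁ w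
      ... | inj₂ m' with cov d m'
      ... | inj₁ m'' = inj₂ m''
      ... | inj₂ refl = inj₁ wr
  ... | V , eqv | no ¬wr =
    let (us , u') = unwind-along u empZ (λ d w → Equivalence.from (eqv d) (inj₁ w))
                      (λ d m → Equivalence.from (eqv d) (inj₂ m)) (λ d m → Equivalence.to (eqv d) m)
    in r ∷ us , undo (V⊆X , X'X r mr , ¬Vr , coverV) u'
    where
      V⊆X : V ⊆ X
      V⊆X d m = [ WX d , (λ m'' → X'X d (sub d m'')) ] (Equivalence.to (eqv d) m)
      ¬Vr : ¬ mem V r
      ¬Vr m = [ ¬wr , ¬mr ] (Equivalence.to (eqv r) m)
      coverV : ∀ d → mem X d → mem V d ⊎ d ≡ r
      coverV d m with cover d m
      ... | inj₁ w = inj₁ (Equivalence.from (eqv d) (inj₁ w))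
      ... | inj₂ m' with cov d m'
      ... | inj₁ m'' = inj₁ (Equivalence.from (eqv d) (inj₂ m''))
      ... | inj₂ d≡r = inj₂ d≡r

  unwind-to : ∀ {X W} → W ⊆ X → Σ[ us ∈ List Ev ] Unwinding X us W
  unwind-to {X} WX = let (rs , Z , empZ , u) = unwind-to-empty X in
    unwind-along u empZ WX (λ d m → m) (λ d m → inj₂ m)

  -- d ≰_X e: some W ⊆ X contains e but not d; unwind X to W, then W to ∅
  non-causal-unwinding : ∀ {X d e} → mem X d → ¬ (d ≤[ X ] e) →
    Σ[ W ∈ Conf ] Σ[ us ∈ List Ev ] Σ[ ws ∈ List Ev ] Σ[ Z ∈ Conf ]
      (Unwinding X us W × Unwinding W ws Z × IsEmpty Z × d ∈ us × e ∈ ws)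
  non-causal-unwinding {X} {d} {e} md d≰e with lem {Σ[ W ∈ Conf ] (W ⊆ X × mem W e × ¬ mem W d)}
  ... | no none = ⊥-elim (d≰e d≤e)
    where
      d≤e : d ≤[ X ] e
      d≤e Y YX me with lem {mem Y d}
      ... | yes md' = md'
      ... | no ¬md' = ⊥-elim (none (Y , YX , me , ¬md'))
  ... | yes (W , WX , we , ¬wd) with unwind-to WX | unwind-to-empty W
  ... | us , u₁ | ws , Z , empZ , u₂ with unwinding-covers u₁ d md | unwinding-covers u₂ e we
  ... | inj₂ wd | _ = ⊥-elim (¬wd wd)
  ... | inj₁ _ | inj₂ ze = ⊥-elim (empZ e ze)
  ... | inj₁ d∈ | inj₁ e∈ = W , us , ws , Z , u₁ , u₂ , empZ , d∈ , e∈

  -- causality between events of a sub-configuration X'' ⊆ X is the same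
  -- computed in X'' or in X (using closure under intersection)
  <-restrict : ∀ {X'' X d e} → X'' ⊆ X → mem X'' e → (d <[ X'' ] e) ⇔ (d <[ X ] e)
  <-restrict {X''} {X} {d} {e} sub me'' = mk⇔
    (λ (le , ne) → to le , ne) (λ (le , ne) → (λ Y YX me → le Y (λ z m → sub z (YX z m)) me) , ne)
    where
      to : d ≤[ X'' ] e → d ≤[ X ] e
      to le Y YX me = let (W , eqv) = inter∈ Y X'' X YX sub in
        proj₁ (Equivalence.to (eqv d)
          (le W (λ z m → proj₂ (Equivalence.to (eqv z) m)) (Equivalence.from (eqv e) (me , me''))))

Names : ∀ {E : Set} → (Id → Maybe E) → List Id → List E → Set
Names ν = Pointwise (λ x r → ν x ≡ just r)

names-lookup : ∀ {E : Set} {ν : Id → Maybe E} {xs rs z} → Names ν xs rs → z ∈ xs →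
               Σ[ r ∈ E ] (ν z ≡ just r × r ∈ rs)
names-lookup (νx ∷ ns) (here refl) = _ , νx , here refl
names-lookup (νx ∷ ns) (there p) = let (r , νz , r∈) = names-lookup ns p in r , νz , there r∈

names-lookup⁻ : ∀ {E : Set} {ν : Id → Maybe E} {xs rs r} → Names ν xs rs → r ∈ rs →
                Σ[ z ∈ Id ] (ν z ≡ just r × z ∈ xs)
names-lookup⁻ (νx ∷ ns) (here refl) = _ , νx , here refl
names-lookup⁻ (νx ∷ ns) (there p) = let (z , νz , z∈) = names-lookup⁻ ns p in z , νz , there z∈

names-build : ∀ {E : Set} {ν : Id → Maybe E} rs → (∀ r → r ∈ rs → Σ[ z ∈ Id ] ν z ≡ just r) →
              Σ[ xs ∈ List Id ] Names ν xs rs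
names-build [] named = [] , []
names-build (r ∷ rs) named =
  let (z , νz) = named r (here refl)
      (xs , ns) = names-build rs (λ r' p → named r' (there p))
  in z ∷ xs , νz ∷ ns

-- if ν (f i) is the i-th element of vs, then f 0, f 1, … name vs (and only
-- vs); the general f makes the induction go through
names-applyUpTo : ∀ {E : Set} {ν : Id → Maybe E} (vs : List E) f → (∀ i → ν (f i) ≡ nth vs i) →
                  Names ν (applyUpTo f (length vs)) vs
names-applyUpTo [] f νf = []
names-applyUpTo (v ∷ vs) f νf = νf 0 ∷ names-applyUpTo vs (f ∘ suc) (νf ∘ suc)

names-upTo : ∀ {E : Set} (vs : List E) → Names (nth vs) (upTo (length vs)) vs
names-upTo vs = names-applyUpTo vs (λ i → i) (λ i → refl)

names-applyUpTo-unique : ∀ {E : Set} {ν : Id → Maybe E} (vs : List E) f {rs} →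
  (∀ i → ν (f i) ≡ nth vs i) → Names ν (applyUpTo f (length vs)) rs → rs ≡ vs
names-applyUpTo-unique [] f νf [] = refl
names-applyUpTo-unique (v ∷ vs) f νf (νf0 ∷ ns) =
  cong₂ _∷_ (just-injective (trans (sym νf0) (νf 0))) (names-applyUpTo-unique vs (f ∘ suc) (νf ∘ suc) ns)

names-upTo-unique : ∀ {E : Set} (vs : List E) {rs} → Names (nth vs) (upTo (length vs)) rs → rs ≡ vs
names-upTo-unique vs = names-applyUpTo-unique vs (λ i → i) (λ i → refl)

module _ {Act : Set} where
  undoing : List Id → Form Act → Form Act
  undoing [] b = b
  undoing (x ∷ xs) b = ⟪ x ⟫ undoing xs b

  hwh-undoing : ∀ xs {b} → Hwh b → Hwh (undoing xs b)
  hwh-undoing [] h = h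
  hwh-undoing (x ∷ xs) h = h-rev (hwh-undoing xs h)

  fi-undoing : ∀ xs b {z} → z ∈ fi (undoing xs b) → z ∈ xs ⊎ z ∈ fi b
  fi-undoing [] b p = inj₂ p
  fi-undoing (x ∷ xs) b p with ∈-++⁻ (fi (undoing xs b)) p
  ... | inj₂ (here refl) = inj₁ (here refl)
  ... | inj₁ q with fi-undoing xs b q
  ... | inj₁ z∈ = inj₁ (there z∈)
  ... | inj₂ zb = inj₂ zb

  bindFrom : ℕ → List Act → Form Act → Form Act
  bindFrom k [] ψ = ψ
  bindFrom k (a ∷ as) ψ = ⦅ k ∶ a ⦆ bindFrom (suc k) as ψ

  bind : List Act → Form Act → Form Act
  bind = bindFrom 0

  hwh-bindFrom : ∀ k as {ψ} → Hwh ψ → Hwh (bindFrom k as ψ)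
  hwh-bindFrom k [] h = h
  hwh-bindFrom k (a ∷ as) h = h-has (hwh-bindFrom (suc k) as h)

  fi-bindFrom : ∀ k as ψ → (∀ z → z ∈ fi ψ → z < k + length as) → ∀ z → z ∈ fi (bindFrom k as ψ) → z < k
  fi-bindFrom k [] ψ bnd z p = subst (z <_) (+-identityʳ k) (bnd z p)
  fi-bindFrom k (a ∷ as) ψ bnd z p with ∈-removeId⁻ (fi (bindFrom (suc k) as ψ)) p
  ... | q , z≢k = ≤∧≢⇒< (≤-pred (fi-bindFrom (suc k) as ψ bnd' z q)) z≢k
    where
      bnd' : ∀ z → z ∈ fi ψ → z < suc k + length as
      bnd' z r = subst (z <_) (+-suc k (length as)) (bnd z r)

  closed-bind : ∀ as ψ → (∀ z → z ∈ fi ψ → z < length as) → Closed (bind as ψ)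
  closed-bind as ψ bnd = closed-intro (bind as ψ) (λ z p → n≮0 (fi-bindFrom 0 as ψ bnd z p))

  ⋀ : ∀ {A : Set} → List A → (A → Form Act) → Form Act
  ⋀ [] g = tt
  ⋀ (a ∷ as) g = g a ∧' ⋀ as g

  hwh-⋀ : ∀ {A : Set} (as : List A) g → (∀ a → Hwh (g a)) → Hwh (⋀ as g)
  hwh-⋀ [] g h = h-tt
  hwh-⋀ (a ∷ as) g h = h-and (h a) (hwh-⋀ as g h)

  fi-⋀ : ∀ {A : Set} (as : List A) g {z} → z ∈ fi (⋀ as g) → Σ[ a ∈ A ] (z ∈ fi (g a))
  fi-⋀ (a ∷ as) g p with ∈-++⁻ (fi (g a)) p
  ... | inj₁ q = a , q
  ... | inj₂ q = fi-⋀ as g q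

tuples : ∀ {A : Set} → List A → ℕ → List (List A)
tuples ys zero = [] ∷ []
tuples ys (suc n) = cartesianProductWith _∷_ ys (tuples ys n)

tuples-complete : ∀ {A : Set} (ys : List A) ts → All (_∈ ys) ts → ts ∈ tuples ys (length ts)
tuples-complete ys [] [] = here refl
tuples-complete ys (t ∷ ts) (t∈ ∷ ts∈) = ∈-cartesianProductWith⁺ _∷_ t∈ (tuples-complete ys ts ts∈)

module DerivedSemantics {Act : Set} (C : ConfStruct Act) where
  open ConfStruct C
  open Coincidence C
  open Unwindings C

  undoing-intro : ∀ {X rs W ν xs b} → Unwinding X rs W → Names ν xs rs →
                  Permissible C ν b W → Sat C W ν b → Sat C X ν (undoing xs b)
  undoing-intro done [] perm s = s
  undoing-intro {ν = ν} {b = b} (undo {X' = X''} st u) (_∷_ {xs = xs} νx ns) perm s =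
    X'' , _ , st , νx , perm' , undoing-intro u ns perm s
    where
      perm' : Permissible C ν (undoing xs b) X''
      perm' z q with fi-undoing xs b q
      ... | inj₁ z∈ = let (r , νz , r∈) = names-lookup ns z∈ in r , νz , proj₁ (unwinding-removed u r∈)
      ... | inj₂ zb = let (r , νz , m) = perm z zb in r , νz , unwinding-⊆ u r m

  undoing-elim : ∀ xs {X ν b} → Sat C X ν (undoing xs b) →
                 Σ[ rs ∈ List Ev ] Σ[ W ∈ Conf ] (Names ν xs rs × Unwinding X rs W × Sat C W ν b)
  undoing-elim [] s = [] , _ , [] , done , s
  undoing-elim (x ∷ xs) (X'' , e , st , νx , _ , s) =
    let (rs , W , ns , u , s') = undoing-elim xs s in e ∷ rs , W , νx ∷ ns , undo st u , s'

  updFrom : Env C → ℕ → List Ev → Env C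
  updFrom ρ k [] = ρ
  updFrom ρ k (t ∷ ts) = updFrom (upd ρ k t) (suc k) ts

  updFrom-below : ∀ ts k ρ x → x < k → updFrom ρ k ts x ≡ ρ x
  updFrom-below [] k ρ x x<k = refl
  updFrom-below (t ∷ ts) k ρ x x<k =
    trans (updFrom-below ts (suc k) (upd ρ k t) x (m≤n⇒m≤1+n x<k)) (upd-neq ρ k t x (<⇒≢ x<k))

  updFrom-nth : ∀ ts k ρ i → i < length ts → updFrom ρ k ts (k + i) ≡ nth ts i
  updFrom-nth (t ∷ ts) k ρ zero _ rewrite +-identityʳ k =
    trans (updFrom-below ts (suc k) (upd ρ k t) k ≤-refl) (upd-eq ρ k t)
  updFrom-nth (t ∷ ts) k ρ (suc i) (s≤s i<) rewrite +-suc k i = updFrom-nth ts (suc k) (upd ρ k t) i i<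

  Labelled : Conf → List Act → List Ev → Set
  Labelled X = Pointwise (λ a t → mem X t × ℓ t ≡ a)

  bindFrom-intro : ∀ as k {X ρ ψ ts} → Labelled X as ts → Sat C X (updFrom ρ k ts) ψ → Sat C X ρ (bindFrom k as ψ)
  bindFrom-intro [] k [] s = s
  bindFrom-intro (a ∷ as) k ((m , l) ∷ lab) s = _ , m , l , bindFrom-intro as (suc k) lab s

  bindFrom-elim : ∀ as k {X ρ ψ} → Sat C X ρ (bindFrom k as ψ) →
                  Σ[ ts ∈ List Ev ] (Labelled X as ts × Sat C X (updFrom ρ k ts) ψ)
  bindFrom-elim [] k s = [] , [] , s
  bindFrom-elim (a ∷ as) k (t , m , l , s) =
    let (ts , lab , s') = bindFrom-elim as (suc k) s in t ∷ ts , (m , l) ∷ lab , s'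

  bind-intro : ∀ as {X ρ ψ ts} → (∀ z → z ∈ fi ψ → z < length as) →
               Labelled X as ts → Sat C X (nth ts) ψ → Sat C X ρ (bind as ψ)
  bind-intro as {ψ = ψ} {ts} bnd lab s = bindFrom-intro as 0 lab (coincide ψ named s)
    where
      named : Agree (nth ts) (updFrom _ 0 ts) ψ
      named z p = sym (updFrom-nth ts 0 _ z (subst (z <_) (Pointwise-length lab) (bnd z p)))

  bind-elim : ∀ as {X ρ ψ} → (∀ z → z ∈ fi ψ → z < length as) → Sat C X ρ (bind as ψ) →
              Σ[ ts ∈ List Ev ] (Labelled X as ts × Sat C X (nth ts) ψ)
  bind-elim as {ρ = ρ} {ψ} bnd s =
    let (ts , lab , s') = bindFrom-elim as 0 s
        named : Agree (updFrom ρ 0 ts) (nth ts) ψ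
        named z p = updFrom-nth ts 0 ρ z (subst (z <_) (Pointwise-length lab) (bnd z p))
    in ts , lab , coincide ψ named s'

  labelled-mem : ∀ {X as ts t} → Labelled X as ts → t ∈ ts → mem X t
  labelled-mem ((m , _) ∷ lab) (here refl) = m
  labelled-mem (_ ∷ lab) (there p) = labelled-mem lab p

  labelled-self : ∀ {X} vs → (∀ d → d ∈ vs → mem X d) → Labelled X (map ℓ vs) vs
  labelled-self [] _ = []
  labelled-self (v ∷ vs) mem-vs = (mem-vs v (here refl) , refl) ∷ labelled-self vs (λ d p → mem-vs d (there p))

  sat-⋀ : ∀ {A : Set} (as : List A) g {X ρ} → Sat C X ρ (⋀ as g) ⇔ All (λ a → Sat C X ρ (g a)) as
  sat-⋀ as g = mk⇔ (to as) (from as)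
    where
      to : ∀ as {X ρ} → Sat C X ρ (⋀ as g) → All (λ a → Sat C X ρ (g a)) as
      to [] _ = []
      to (a ∷ as) (s , t) = s ∷ to as t
      from : ∀ as {X ρ} → All (λ a → Sat C X ρ (g a)) as → Sat C X ρ (⋀ as g)
      from [] [] = tt
      from (a ∷ as) (s ∷ t) = s , from as t

module _ {Act : Set} (C D : ConfStruct Act) where
  private
    module C = ConfStruct C
    module D = ConfStruct D

  Equiv : C.Conf → D.Conf → Rel C D → Set
  Equiv X Y f = ∀ φ → Hwh φ → ∀ ρ σ → Corr C D f ρ σ φ → Sat C X ρ φ ⇔ Sat D Y σ φ

  Related : C.Conf → D.Conf → Rel C D → Set
  Related X Y f = Iso C D X Y f × Equiv X Y f

Bounded : ∀ {Act} → ℕ → Form Act → Set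
Bounded n φ = ∀ z → z ∈ fi φ → z < n

module Reflection {Act : Set} (S T : ConfStruct Act) where
  private
    module S = ConfStruct S
    module T = ConfStruct T
  open Unwindings
  open DerivedSemantics

  Preserves : S.Conf → List S.Ev → T.Conf → List T.Ev → Set
  Preserves V vs W ws = ∀ φ → Hwh φ → Bounded (length vs) φ → Sat S V (nth vs) φ → Sat T W (nth ws) φ

  named-bounded : ∀ {E : Set} (vs : List E) {xs rs z} → Names (nth vs) xs rs → z ∈ xs → z < length vs
  named-bounded vs ns z∈ = let (_ , vz , _) = names-lookup ns z∈ in nth-< vs _ vz

  enumeration-transfer : ∀ {V vs W ws} → Enumeration S V vs → length ws ≡ length vs →
                         Preserves V vs W ws → Enumeration T W ws
  enumeration-transfer {V} {vs} {W} {ws} (Z , empZ , u) len preserves =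
    W₀ , empW₀ , u₀
    where
      through : ∀ b → Closed b → Hwh b → Sat S Z (nth vs) b →
                Σ[ W' ∈ T.Conf ] (Unwinding T W ws W' × Sat T W' (nth ws) b)
      through b cl h s with undoing-elim T (upTo (length vs))
          (preserves (undoing (upTo (length vs)) b) (hwh-undoing _ h) bounded
            (undoing-intro S u (names-upTo vs) (λ z p → ⊥-elim (closed-∉ {φ = b} cl p)) s))
        where
          bounded : Bounded (length vs) (undoing (upTo (length vs)) b)
          bounded z p = [ ∈-upTo⁻ , (λ q → ⊥-elim (closed-∉ {φ = b} cl q)) ] (fi-undoing (upTo (length vs)) b p)
      ... | rs , W' , ns , u' , s'
        with names-upTo-unique ws (subst (λ k → Names (nth ws) (upTo k) rs) (sym len) ns)
      ... | refl = W' , u' , s'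

      W₀ : T.Conf
      W₀ = proj₁ (through tt refl h-tt tt)
      u₀ : Unwinding T W ws W₀
      u₀ = proj₁ (proj₂ (through tt refl h-tt tt))

      -- an event e left over would survive undoing all of ws, contradicting
      -- the absence of ℓ(e)-labelled events at ∅
      empW₀ : T.IsEmpty W₀
      empW₀ e m with through (¬' (⦅ 0 ∶ T.ℓ e ⦆ tt)) refl (h-neg (h-has h-tt)) (λ (d , md , _) → empZ d md)
      ... | W₁ , u₁ , s₁ with unwinding-covers T u₁ e (unwinding-⊆ T u₀ e m)
      ... | inj₁ e∈ = proj₂ (unwinding-removed T u₀ e∈) m
      ... | inj₂ m₁ = s₁ (e , m₁ , refl , tt)

  position-named : ∀ {V vs xs us i d} → Enumeration S V vs → Names (nth vs) xs us → d ∈ us →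
                   nth vs i ≡ just d → i ∈ xs
  position-named {vs = vs} {i = i} enum ns d∈ vd with names-lookup⁻ ns d∈
  ... | z , vz , z∈ with enum-distinct S enum z i vz vd
  ... | refl = z∈

  named-event : ∀ {ν : Id → Maybe T.Ev} {xs rs i e} → Names ν xs rs → i ∈ xs → ν i ≡ just e → e ∈ rs
  named-event ns i∈ νi with names-lookup ns i∈
  ... | r , νi' , r∈ with just-injective (trans (sym νi) νi')
  ... | refl = r∈

  module _ (lem : ExcludedMiddle 0ℓ) (StS : Stable S) where
    open StableUnwinding lem S StS using (non-causal-unwinding)

    -- d ≰ d' is witnessed by undoing d before d'; transfer that formula
    independence-transfer : ∀ {V vs W ws i j d d' e e'} → Enumeration S V vs → Preserves V vs W ws →
      nth vs i ≡ just d → nth vs j ≡ just d' → nth ws i ≡ just e → nth ws j ≡ just e' →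
      ¬ (d S.≤[ V ] d') → ¬ (e T.≤[ W ] e')
    independence-transfer {V} {vs} {W} {ws} {i} {j} enum preserves vd vd' we we' d≰d'
      with non-causal-unwinding (enum-member S enum (nth-∈ vs i vd)) d≰d'
    ... | V₁ , us , us' , Z , u₁ , u₂ , empZ , d∈ , d'∈
      with names-build us (λ r p → named r (proj₁ (unwinding-removed S u₁ p)))
         | names-build us' (λ r p → named r (unwinding-⊆ S u₁ r (proj₁ (unwinding-removed S u₂ p))))
      where
        named : ∀ r → S.mem V r → Σ[ z ∈ Id ] nth vs z ≡ just r
        named r m = ∈-nth vs (enum-listed S enum m)
    ... | xs₁ , ns₁ | xs₂ , ns₂
      with undoing-elim T xs₁ (preserves (undoing xs₁ (undoing xs₂ tt))
             (hwh-undoing xs₁ (hwh-undoing xs₂ h-tt)) bounded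
             (undoing-intro S u₁ ns₁ perm (undoing-intro S u₂ ns₂ (λ _ ()) tt)))
      where
        perm : Permissible S (nth vs) (undoing xs₂ tt) V₁
        perm z p with fi-undoing xs₂ tt p
        ... | inj₁ z∈ = let (r , vz , r∈) = names-lookup ns₂ z∈ in r , vz , proj₁ (unwinding-removed S u₂ r∈)
        bounded : Bounded (length vs) (undoing xs₁ (undoing xs₂ tt))
        bounded z p with fi-undoing xs₁ _ p
        ... | inj₁ z∈ = named-bounded vs ns₁ z∈
        ... | inj₂ q with fi-undoing xs₂ tt q
        ... | inj₁ z∈ = named-bounded vs ns₂ z∈
    ... | rs₁ , W₁ , ns₁' , u₁' , s₁ with undoing-elim T xs₂ s₁
    ... | rs₂ , W₂ , ns₂' , u₂' , _ =
      λ e≤e' → e∉W₁ (e≤e' W₁ (unwinding-⊆ T u₁') e'∈W₁)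
      where
        e∉W₁ : ¬ T.mem W₁ _
        e∉W₁ = proj₂ (unwinding-removed T u₁' (named-event ns₁' (position-named enum ns₁ d∈ vd) we))
        e'∈W₁ : T.mem W₁ _
        e'∈W₁ = proj₁ (unwinding-removed T u₂' (named-event ns₂' (position-named enum ns₂ d'∈ vd') we'))

pointwise-nth : ∀ {A B : Set} {R : A → B → Set} {as bs} → Pointwise R as bs →
                ∀ i {a b} → nth as i ≡ just a → nth bs i ≡ just b → R a b
pointwise-nth (r ∷ rs) zero refl refl = r
pointwise-nth (r ∷ rs) (suc i) p q = pointwise-nth rs i p q

nth-map : ∀ {A B : Set} (g : A → B) (xs : List A) i {x} → nth xs i ≡ just x → nth (map g xs) i ≡ just (g x)
nth-map g (x ∷ xs) zero refl = refl
nth-map g (x ∷ xs) (suc i) p = nth-map g xs i p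

module IndexCorrespondence {Act : Set} (lem : ExcludedMiddle 0ℓ) (C D : ConfStruct Act)
  (StC : Stable C) (StD : Stable D) {X' : ConfStruct.Conf C} {es : List (ConfStruct.Ev C)}
  {Y' : ConfStruct.Conf D} {ts : List (ConfStruct.Ev D)}
  (enumX : Unwindings.Enumeration C X' es)
  (labels : DerivedSemantics.Labelled D Y' (map (ConfStruct.ℓ C) es) ts)
  (canon : ∀ φ → Hwh φ → Bounded (length es) φ → Sat C X' (nth es) φ ⇔ Sat D Y' (nth ts) φ) where
  private
    module C = ConfStruct C
    module D = ConfStruct D
  open Unwindings
  open Coincidence using (coincide⇔)

  length-ts : length ts ≡ length es
  length-ts = trans (sym (Pointwise-length labels)) (length-map C.ℓ es)

  enumY : Enumeration D Y' ts
  enumY = Reflection.enumeration-transfer C D enumX length-ts (λ φ h b → Equivalence.to (canon φ h b))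

  index : Rel C D
  index d e = Σ[ i ∈ ℕ ] (nth es i ≡ just d × nth ts i ≡ just e)

  index-functional : ∀ {d e e'} → index d e → index d e' → e ≡ e'
  index-functional (i , p , q) (j , p' , q') with enum-distinct C enumX i j p p'
  ... | refl = just-injective (trans (sym q) q')

  index-injective : ∀ {d d' e} → index d e → index d' e → d ≡ d'
  index-injective (i , p , q) (j , p' , q') with enum-distinct D enumY i j q q'
  ... | refl = just-injective (trans (sym p) p')

  -- causal order is preserved and reflected: independence transfers both ways
  index-≤ : ∀ {d d' e e'} → index d e → index d' e' → (d C.≤[ X' ] d') ⇔ (e D.≤[ Y' ] e')
  index-≤ {d} {d'} {e} {e'} (i , p , q) (j , p' , q') = mk⇔ to from
    where
      to : d C.≤[ X' ] d' → e D.≤[ Y' ] e'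
      to d≤d' with lem {e D.≤[ Y' ] e'}
      ... | yes e≤e' = e≤e'
      ... | no e≰e' = ⊥-elim (Reflection.independence-transfer D C lem StD {ws = es} enumY
                        (λ φ h b → Equivalence.from (canon φ h (subst (λ k → Bounded k φ) length-ts b)))
                        q q' p p' e≰e' d≤d')
      from : e D.≤[ Y' ] e' → d C.≤[ X' ] d'
      from e≤e' with lem {d C.≤[ X' ] d'}
      ... | yes d≤d' = d≤d'
      ... | no d≰d' = ⊥-elim (Reflection.independence-transfer C D lem StC {ws = ts} enumX
                        (λ φ h b → Equivalence.to (canon φ h b)) p p' q q' d≰d' e≤e')

  index-iso : Iso C D X' Y' index
  index-iso = record
    { dom⊆ = λ d e (i , p , q) → enum-member C enumX (nth-∈ es i p) , enum-member D enumY (nth-∈ ts i q)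
    ; total = total
    ; func = λ d e e' → index-functional
    ; inj = λ d d' e → index-injective
    ; surj = surj
    ; label = λ d e (i , p , q) → sym (proj₂ (pointwise-nth labels i (nth-map C.ℓ es i p) q))
    ; order = λ d d' e e' de d'e' → mk⇔
        (λ (le , ne) → Equivalence.to (index-≤ de d'e') le , (λ { refl → ne (index-injective de d'e') }))
        (λ (le , ne) → Equivalence.from (index-≤ de d'e') le , (λ { refl → ne (index-functional de d'e') })) }
    where
      total : ∀ d → C.mem X' d → Σ[ e ∈ D.Ev ] index d e
      total d m with ∈-nth es (enum-listed C enumX m)
      ... | i , p with nth-defined ts i (subst (i <_) (sym length-ts) (nth-< es i p))
      ... | e , q = e , i , p , q
      surj : ∀ e → D.mem Y' e → Σ[ d ∈ C.Ev ] index d e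
      surj e m with ∈-nth ts (enum-listed D enumY m)
      ... | i , q with nth-defined es i (subst (i <_) length-ts (nth-< ts i q))
      ... | d , p = d , i , p , q

  -- rename each free identifier y of φ to the position of the event it
  -- denotes; then φ becomes a bounded formula and canon applies
  index-equiv : Equiv C D X' Y' index
  index-equiv φ h ρ σ c =
    ⇔-trans (coincide⇔ C φ (λ y p → sym (proj₁ (position-spec y p))))
      (⇔-trans (⇔-sym (Renaming.sat-rename C φ position))
        (⇔-trans (canon (rename position φ) (hwh-rename position h) bounded)
          (⇔-trans (Renaming.sat-rename D φ position) (coincide⇔ D φ (λ y p → proj₂ (position-spec y p))))))
    where
      position′ : ∀ y → Dec (y ∈ fi φ) → ℕ
      position′ y (yes p) = proj₁ (proj₂ (proj₂ (proj₂ (proj₂ (c y p)))))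
      position′ y (no _) = 0

      position : Id → ℕ
      position y = position′ y (y ∈? fi φ)

      position′-spec : ∀ y (dec : Dec (y ∈ fi φ)) → y ∈ fi φ →
                       nth es (position′ y dec) ≡ ρ y × nth ts (position′ y dec) ≡ σ y
      position′-spec y (yes p) _ =
        let (d , e , ρy , σy , (i , esi , tsi)) = c y p in trans esi (sym ρy) , trans tsi (sym σy)
      position′-spec y (no ¬p) p = ⊥-elim (¬p p)

      position-spec : ∀ y → y ∈ fi φ → nth es (position y) ≡ ρ y × nth ts (position y) ≡ σ y
      position-spec y = position′-spec y (y ∈? fi φ)

      bounded : Bounded (length es) (rename position φ)
      bounded z p with fi-rename⁻ position φ p
      ... | y , y∈ , refl with c y y∈
      ... | d , e , ρy , _ = nth-< es (position y) (trans (proj₁ (position-spec y y∈)) ρy)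

undo-transfer : ∀ {Act} (S T : ConfStruct Act) {X'' e X Y'' e' Y} →
  ConfStruct.Step S X'' e X → ConfStruct.Step T Y'' e' Y → ∀ φ ρ σ → Permissible S ρ φ X'' →
  (Sat S X (Coincidence.upd S ρ (fresh (fi φ)) e) (⟪ fresh (fi φ) ⟫ φ) →
   Sat T Y (Coincidence.upd T σ (fresh (fi φ)) e') (⟪ fresh (fi φ) ⟫ φ)) →
  Sat S X'' ρ φ → Sat T Y'' σ φ
undo-transfer S T {X''} {e} {e' = e'} stX stY φ ρ σ perm lifted s =
  coincide T φ (λ y p → fresh-upd T σ e' y p)
    (undo-determined T {x = x} {φ = φ} stY (upd-eq T σ x e')
      (lifted (X'' , e , stX , upd-eq S ρ x e , perm' , coincide S φ (λ y p → sym (fresh-upd S ρ e y p)) s)))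
  where
    open Coincidence
    x : Id
    x = fresh (fi φ)
    fresh-upd : ∀ U ν d y → y ∈ fi φ → upd U ν x d y ≡ ν y
    fresh-upd U ν d y p = upd-neq U ν x d y (fresh-≢ (fi φ) p)
    perm' : Permissible S (upd S ρ x e) φ X''
    perm' y p = let (d , ρy , m) = perm y p in d , trans (fresh-upd S ρ e y p) ρy , m

module Completeness {Act : Set} (lem : ExcludedMiddle 0ℓ) (C D : ConfStruct Act)
  (StC : Stable C) (StD : Stable D) where
  private
    module C = ConfStruct C
    module D = ConfStruct D
  open Coincidence using (upd; upd-eq; upd-neq)

  restrictTo : Rel C D → C.Conf → Rel C D
  restrictTo f X'' d e = f d e × C.mem X'' d

  module Restriction {X Y f X'' e Y'' e'} (I : Iso C D X Y f)
    (stX : C.Step X'' e X) (stY : D.Step Y'' e' Y) (fee' : f e e') where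

    restrict-into : ∀ d d' → restrictTo f X'' d d' → D.mem Y'' d'
    restrict-into d d' (fdd' , md) with proj₂ (proj₂ (proj₂ stY)) d' (proj₂ (Iso.dom⊆ I d d' fdd'))
    ... | inj₁ m = m
    ... | inj₂ refl with Iso.inj I d e e' fdd' fee'
    ... | refl = ⊥-elim (proj₁ (proj₂ (proj₂ stX)) md)

    restrict-iso : Iso C D X'' Y'' (restrictTo f X'')
    restrict-iso = record
      { dom⊆ = λ d d' r → proj₂ r , restrict-into d d' r
      ; total = λ d m → let (d' , fdd') = Iso.total I d (proj₁ stX d m) in d' , fdd' , m
      ; func = λ d e₁ e₂ r r' → Iso.func I d e₁ e₂ (proj₁ r) (proj₁ r')
      ; inj = λ d₁ d₂ d' r r' → Iso.inj I d₁ d₂ d' (proj₁ r) (proj₁ r')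
      ; surj = surj
      ; label = λ d d' r → Iso.label I d d' (proj₁ r)
      ; order = λ d₁ d₂ e₁ e₂ r r' →
          ⇔-trans (StableUnwinding.<-restrict lem C StC (proj₁ stX) (proj₂ r'))
            (⇔-trans (Iso.order I d₁ d₂ e₁ e₂ (proj₁ r) (proj₁ r'))
              (⇔-sym (StableUnwinding.<-restrict lem D StD (proj₁ stY) (restrict-into d₂ e₂ r')))) }
      where
        surj : ∀ d' → D.mem Y'' d' → Σ[ d ∈ C.Ev ] restrictTo f X'' d d'
        surj d' m with Iso.surj I d' (proj₁ stY d' m)
        ... | d , fdd' with proj₂ (proj₂ (proj₂ stX)) d (proj₁ (Iso.dom⊆ I d d' fdd'))
        ... | inj₁ md = d , fdd' , md
        ... | inj₂ refl with Iso.func I d d' e' fdd' fee'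
        ... | refl = ⊥-elim (proj₁ (proj₂ (proj₂ stY)) m)

    restrict-equiv : Equiv C D X Y f → Equiv C D X'' Y'' (restrictTo f X'')
    restrict-equiv E φ h ρ σ c = mk⇔
      (undo-transfer C D stX stY φ ρ σ permX (Equivalence.to (E (⟪ x ⟫ φ) (h-rev h) ρ' σ' c')))
      (undo-transfer D C stY stX φ σ ρ permY (Equivalence.from (E (⟪ x ⟫ φ) (h-rev h) ρ' σ' c')))
      where
        x : Id
        x = fresh (fi φ)
        ρ' : Env C
        ρ' = upd C ρ x e
        σ' : Env D
        σ' = upd D σ x e'
        c' : Corr C D f ρ' σ' (⟪ x ⟫ φ)
        c' y q with ∈-++⁻ (fi φ) q
        ... | inj₂ (here refl) = e , e' , upd-eq C ρ y e , upd-eq D σ y e' , fee'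
        ... | inj₁ p = let (d , d' , ρy , σy , (fdd' , _)) = c y p in
          d , d' , trans (upd-neq C ρ x e y (fresh-≢ (fi φ) p)) ρy ,
          trans (upd-neq D σ x e' y (fresh-≢ (fi φ) p)) σy , fdd'
        permX : Permissible C ρ φ X''
        permX y p = let (d , d' , ρy , _ , (_ , md)) = c y p in d , ρy , md
        permY : Permissible D σ φ Y''
        permY y p = let (d , d' , _ , σy , r) = c y p in d' , σy , restrict-into d d' r

  -- the image of an undone event can be undone as well (witnessed by ⟨⟨0⟩⟩tt)
  matching-step : ∀ {X Y f X'' e e'} → Equiv C D X Y f → C.Step X'' e X → f e e' →
                  Σ[ Y'' ∈ D.Conf ] D.Step Y'' e' Y
  matching-step {X} {Y} {f} {X''} {e} {e'} E stX fee'
    with Equivalence.to (E (⟪ 0 ⟫ tt) (h-rev h-tt) (upd C (emptyEnv C) 0 e) (upd D (emptyEnv D) 0 e') corr)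
           (X'' , e , stX , upd-eq C (emptyEnv C) 0 e , (λ _ ()) , tt)
    where
      corr : Corr C D f (upd C (emptyEnv C) 0 e) (upd D (emptyEnv D) 0 e') (⟪ 0 ⟫ tt)
      corr .0 (here refl) = e , e' , upd-eq C (emptyEnv C) 0 e , upd-eq D (emptyEnv D) 0 e' , fee'
  ... | Y'' , e₂ , stY , σ0 , _ with just-injective (trans (sym (upd-eq D (emptyEnv D) 0 e')) σ0)
  ... | refl = Y'' , stY

  related-bwd : ∀ X Y f a X'' → Related C D X Y f → C.StepA X'' a X →
    Σ[ Y'' ∈ D.Conf ] Σ[ f' ∈ Rel C D ] (D.StepA Y'' a Y × Related C D X'' Y'' f' × Restricts C D f X'' f')
  related-bwd X Y f a X'' (I , E) (e , stX , ℓe) =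
    let (e' , fee') = Iso.total I e (proj₁ (proj₂ stX))
        (Y'' , stY) = matching-step E stX fee'
        open Restriction I stX stY fee'
    in Y'' , restrictTo f X'' , (e' , stY , trans (sym (Iso.label I e e' fee')) ℓe) ,
       (restrict-iso , restrict-equiv E) , (λ d d' → mk⇔ (λ r → r) (λ r → r))

  -- Some a-successor Y' of Y, with a
  -- list ts of events labelled like es, agrees with (X', nth es) on all
  -- bounded formulas; otherwise, by image finiteness, a single formula
  -- ⟨a⟩(0:ℓe₀)…(n-1:ℓeₙ₋₁)Ψ, Ψ a conjunction of distinguishing formulas for
  -- all candidates, would hold at X but not at Y.  The index correspondence
  -- of such es, ts then relates X' and Y'.
  module Forward (IFD : D.ImageFinite) {X Y f} (rel : Related C D X Y f) {a X'} (stX : C.StepA X a X') where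
    open DerivedSemantics using (Labelled)

    es : List C.Ev
    es = proj₁ (StableUnwinding.unwind-to-empty lem C StC X')

    enumX : Unwindings.Enumeration C X' es
    enumX = proj₂ (StableUnwinding.unwind-to-empty lem C StC X')

    n : ℕ
    n = length es

    CanonEquiv : D.Conf → List D.Ev → Set
    CanonEquiv Y' ts = ∀ φ → Hwh φ → Bounded n φ → Sat C X' (nth es) φ ⇔ Sat D Y' (nth ts) φ

    Candidate : D.Conf → List D.Ev → Set
    Candidate Y' ts = D.StepA Y a Y' × Labelled D Y' (map C.ℓ es) ts

    Matching : Set
    Matching = Σ[ Y' ∈ D.Conf ] Σ[ ts ∈ List D.Ev ] (Candidate Y' ts × CanonEquiv Y' ts)

    Distinguishes : D.Conf → List D.Ev → Form Act → Set
    Distinguishes Y' ts ψ =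
      Hwh ψ × Bounded n ψ × Sat C X' (nth es) ψ × (Candidate Y' ts → ¬ Sat D Y' (nth ts) ψ)

    distinguish : ¬ Matching → ∀ Y' ts → Σ[ ψ ∈ Form Act ] Distinguishes Y' ts ψ
    distinguish ¬match Y' ts with lem {Candidate Y' ts}
    ... | no ¬cand = tt , h-tt , (λ z ()) , tt , (λ cand _ → ¬cand cand)
    ... | yes cand with lem {Σ[ φ ∈ Form Act ] (Hwh φ × Bounded n φ × ¬ (Sat C X' (nth es) φ ⇔ Sat D Y' (nth ts) φ))}
    ... | no none = ⊥-elim (¬match (Y' , ts , cand , canon))
      where
        canon : CanonEquiv Y' ts
        canon φ h b with lem {Sat C X' (nth es) φ ⇔ Sat D Y' (nth ts) φ}
        ... | yes eqv = eqv
        ... | no ¬eqv = ⊥-elim (none (φ , h , b , ¬eqv))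
    ... | yes (φ , h , b , ¬eqv) with lem {Sat C X' (nth es) φ}
    ... | yes sX = φ , h , b , sX , (λ _ sY → ¬eqv (mk⇔ (λ _ → sY) (λ _ → sX)))
    ... | no ¬sX = ¬' φ , h-neg h , b , ¬sX ,
                   (λ _ ¬sY → ¬eqv (mk⇔ (λ sX → ⊥-elim (¬sX sX)) (λ sY → ⊥-elim (¬sY sY))))

    module Characteristic (¬match : ¬ Matching) where
      open DerivedSemantics

      distinguisher : D.Conf → List D.Ev → Form Act
      distinguisher Y' ts = proj₁ (distinguish ¬match Y' ts)

      successors : List D.Conf
      successors = proj₁ (IFD Y a)

      events : D.Conf → List D.Ev
      events Y' = proj₁ (D.conf-fin Y')

      Ψ : Form Act
      Ψ = ⋀ successors (λ Y' → ⋀ (tuples (events Y') n) (distinguisher Y'))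

      hwh-Ψ : Hwh Ψ
      hwh-Ψ = hwh-⋀ successors _ (λ Y' → hwh-⋀ _ _ (λ ts → proj₁ (proj₂ (distinguish ¬match Y' ts))))

      bounded-Ψ : Bounded n Ψ
      bounded-Ψ z p with fi-⋀ successors _ p
      ... | Y' , q with fi-⋀ (tuples (events Y') n) _ q
      ... | ts , r = proj₁ (proj₂ (proj₂ (distinguish ¬match Y' ts))) z r

      sat-Ψ : Sat C X' (nth es) Ψ
      sat-Ψ = Equivalence.from (sat-⋀ C successors _) (All.tabulate λ {Y'} _ →
                Equivalence.from (sat-⋀ C _ _) (All.tabulate λ {ts} _ →
                  proj₁ (proj₂ (proj₂ (proj₂ (distinguish ¬match Y' ts))))))

      bounded-labels : Bounded (length (map C.ℓ es)) Ψ
      bounded-labels z p = subst (z <_) (sym (length-map C.ℓ es)) (bounded-Ψ z p)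

      Φ : Form Act
      Φ = bind (map C.ℓ es) Ψ

      closed-Φ : Closed Φ
      closed-Φ = closed-bind (map C.ℓ es) Ψ bounded-labels

      hwh-◇Φ : Hwh (⟨ 0 ∶ a ⟩ Φ)
      hwh-◇Φ = h-diam closed-Φ (hwh-bindFrom 0 (map C.ℓ es) hwh-Ψ)

      closed-◇Φ : Closed (⟨ 0 ∶ a ⟩ Φ)
      closed-◇Φ = closed-intro (⟨ 0 ∶ a ⟩ Φ) (λ z p → closed-∉ {φ = Φ} closed-Φ (proj₁ (∈-removeId⁻ (fi Φ) p)))

      sat-X : Sat C X (emptyEnv C) (⟨ 0 ∶ a ⟩ Φ)
      sat-X = let (e , st , ℓe) = stX in
        X' , e , st , ℓe , bind-intro C (map C.ℓ es) bounded-labels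
          (labelled-self C es (λ d p → Unwindings.enum-member C enumX p)) sat-Ψ

      -- so it holds at Y: some successor Y' and events ts satisfy Ψ, in
      -- particular their own distinguishing formula
      refuted : ⊥
      refuted with Equivalence.to (proj₂ rel (⟨ 0 ∶ a ⟩ Φ) hwh-◇Φ (emptyEnv C) (emptyEnv D)
                                     (corr-closed C D {φ = ⟨ 0 ∶ a ⟩ Φ} closed-◇Φ)) sat-X
      ... | Y' , e' , stY , ℓe' , sY with bind-elim D (map C.ℓ es) bounded-labels sY
      ... | ts , lab , sΨ =
        proj₂ (proj₂ (proj₂ (proj₂ (distinguish ¬match Y' ts)))) (step , lab)
          (All.lookup (Equivalence.to (sat-⋀ D _ _) (All.lookup (Equivalence.to (sat-⋀ D successors _) sΨ) Y'∈)) ts∈)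
        where
          step : D.StepA Y a Y'
          step = e' , stY , ℓe'
          Y'∈ : Y' ∈ successors
          Y'∈ = proj₂ (IFD Y a) Y' step
          ts∈ : ts ∈ tuples (events Y') n
          ts∈ = subst (λ k → ts ∈ tuples (events Y') k) (trans (sym (Pointwise-length lab)) (length-map C.ℓ es))
                  (tuples-complete (events Y') ts
                    (All.tabulate λ {t} t∈ → Equivalence.to (proj₂ (D.conf-fin Y') t) (labelled-mem D lab t∈)))

    matching : Matching
    matching with lem {Matching}
    ... | yes m = m
    ... | no ¬match = ⊥-elim (Characteristic.refuted ¬match)

    related-fwd : Σ[ Y' ∈ D.Conf ] Σ[ g ∈ Rel C D ] (D.StepA Y a Y' × Related C D X' Y' g)
    related-fwd =
      let (Y' , ts , (stY , lab) , canon) = matching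
          open IndexCorrespondence lem C D StC StD enumX lab canon
      in Y' , index , stY , index-iso , index-equiv

related-transpose : ∀ {Act} {C D : ConfStruct Act} {X Y f} → Related C D X Y f → Related D C Y X (transpose f)
related-transpose {C = C} {D} (I , E) =
  iso-transpose I , λ φ h σ ρ c → ⇔-sym (E φ h ρ σ (corr-transpose {C = D} {D = C} φ c))

-- the empty configurations are related by the empty relation: on closed
-- formulas this is exactly C ≡_{EIL_hwh} D
related-empty : ∀ {Act} (C D : ConfStruct Act) {X₀ Y₀} →
  ConfStruct.IsEmpty C X₀ → ConfStruct.IsEmpty D Y₀ → EquivHwh C D → Related C D X₀ Y₀ (EmptyRel C D)
related-empty C D {X₀} {Y₀} empX₀ empY₀ equiv = iso₀ , equiv₀
  where
    open Coincidence using (closed-coincide; empty-unique)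
    iso₀ : Iso C D X₀ Y₀ (EmptyRel C D)
    iso₀ = record
      { dom⊆ = λ _ _ ()
      ; total = λ d m → ⊥-elim (empX₀ d m)
      ; func = λ _ _ _ ()
      ; inj = λ _ _ _ ()
      ; surj = λ e m → ⊥-elim (empY₀ e m)
      ; label = λ _ _ ()
      ; order = λ _ _ _ _ () }
    equiv₀ : Equiv C D X₀ Y₀ (EmptyRel C D)
    equiv₀ φ h ρ σ c = mk⇔ to from
      where
        cl : Closed φ
        cl = closed-intro φ (λ z p → proj₂ (proj₂ (proj₂ (proj₂ (c z p)))))
        to : Sat C X₀ ρ φ → Sat D Y₀ σ φ
        to s with Equivalence.to (equiv φ h cl) (X₀ , empX₀ , closed-coincide C {φ = φ} cl s)
        ... | Y , empY , s' rewrite empty-unique D empY empY₀ = closed-coincide D {φ = φ} cl s'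
        from : Sat D Y₀ σ φ → Sat C X₀ ρ φ
        from s with Equivalence.from (equiv φ h cl) (Y₀ , empY₀ , closed-coincide D {φ = φ} cl s)
        ... | X , empX , s' rewrite empty-unique C empX empX₀ = closed-coincide C {φ = φ} cl s'

-- The candidate relation is an HWH bisimulation; the D-side clauses are the
-- C-side clauses for the transposed structures.
completeness : ∀ {Act} → ExcludedMiddle 0ℓ → (C D : ConfStruct Act) → Stable C → Stable D →
  ConfStruct.ImageFinite C → ConfStruct.ImageFinite D → EquivHwh C D → HWHBisimilar C D
completeness lem C D StC StD IFC IFD equiv =
  Related C D , hwh , X₀ , Y₀ , empX₀ , empY₀ , related-empty C D empX₀ empY₀ equiv
  where
    module CD = Completeness lem C D StC StD
    module DC = Completeness lem D C StD StC
    X₀ : ConfStruct.Conf C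
    X₀ = proj₁ (Stable.empty∈ StC)
    empX₀ : ConfStruct.IsEmpty C X₀
    empX₀ = proj₂ (Stable.empty∈ StC)
    Y₀ : ConfStruct.Conf D
    Y₀ = proj₁ (Stable.empty∈ StD)
    empY₀ : ConfStruct.IsEmpty D Y₀
    empY₀ = proj₂ (Stable.empty∈ StD)
    hwh : IsHWH C D (Related C D)
    hwh = record
      { iso = λ X Y f → proj₁
      ; fwdC = λ X Y f a X' r st → CD.Forward.related-fwd IFD r st
      ; fwdD = λ X Y f a Y' r st →
          let (X' , g , st' , r') = DC.Forward.related-fwd IFC (related-transpose r) st
          in X' , transpose g , st' , related-transpose r'
      ; bwdC = CD.related-bwd
      ; bwdD = λ X Y f a Y' r st →
          let (X' , g , st' , r' , res) = DC.related-bwd Y X (transpose f) a Y' (related-transpose r) st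
          in X' , transpose g , st' , related-transpose r' ,
             restricts-transpose (iso-transpose (proj₁ r)) (proj₁ r') res }

theorem4 : ExcludedMiddle 0ℓ → {Act : Set} → (C D : ConfStruct Act) →
    Stable C → Stable D → ConfStruct.ImageFinite C → ConfStruct.ImageFinite D →
    HWHBisimilar C D ⇔ EquivHwh C D
theorem4 lem C D StC StD IFC IFD =
  mk⇔ (soundness C D) (completeness lem C D StC StD IFC IFD)
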